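{- Let $\mathfrak G=\{G_i\}_{i\in I}$ be a family of finite groups. Then the mapping $\mathcal X\mapsto\mathcal T(\mathcal X)$ gives a one-to-one correspondence between the quasiregular coherent configurations of type $\mathfrak G$ and the systems of linked quotients based on $\mathfrak G$.
   Context: A coherent configuration is a pair $(\Omega,S)$ where $\Omega$ is a finite set and $S$ is a partition of $\Omega\times\Omega$ (basis relations) such that $1_\Omega$ is a union of basis relations, $s^*=\{(\beta,\alpha):(\alpha,\beta)\in s\}\in S$ for all $s\in S$, and for all $r,s,t\in S$ the number $|\alpha r\cap\beta s^*|$ is independent of $(\alpha,\beta)\in t$, where $\alpha r=\{\beta:(\alpha,\beta)\in r\}$. A fiber is a set $\Delta$ with $1_\Delta\in S$. A relation $s$ is thin if $|\alpha s|\le1$ and $|\alpha s^*|\le1$ for all $\alpha$. The configuration is quasiregular if for each fiber all basis relations contained in its square are thin; it is of type $\mathfrak G$ if its fibers are $\Omega_i$, $i\in I$, and the group (under composition of relations) of basis relations contained in $\Omega_i\times\Omega_i$ is $G_i$. The complex product $rs$ of basis relations is the set of basis relations contained in $\{(\alpha,\beta):(\alpha,\gamma)\in r,(\gamma,\beta)\in s\text{ for some }\gamma\}$, extended to sets by $XY=\bigcup_{r\in X,s\in Y}rs$. For such $\mathcal X$, $\mathcal T(\mathcal X)=(\{G_i\},\{G_i/G_{ij}\},\{f_{ij}\})$ where, after choosing $\alpha_i\in\Omega_i$ and letting $s_{ij}$ be the basis relation containing $(\alpha_i,\alpha_j)$, $G_{ij}=s_{ij}s_{ij}^*\trianglelefteq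 G_i$ and $f_{ij}:G_i/G_{ij}\to G_j/G_{ji}$, $G_{ij}s\mapsto s_{ij}^*(G_{ij}s)s_{ij}$. A system of linked quotients based on $\{G_i\}_{i\in I}$ consists of normal subgroups $G_{ij}\trianglelefteq G_i$ with $G_{ii}=1$ and isomorphisms $f_{ij}:G_i/G_{ij}\to G_j/G_{ji}$ with $f_{ii}=\mathrm{id}$, $f_{ij}f_{ji}=\mathrm{id}$, such that for all $i,j,k$: $f_{ik}$ maps $G_{ij}G_{ik}/G_{ik}$ onto $G_{ki}G_{kj}/G_{ki}$ (inducing $f_{ijk}:G_i/G_{ij}G_{ik}\to G_k/G_{ki}G_{kj}$), and the composite of $f_{ijk}$, then $f_{kij}$, then $f_{jki}$ is the identity of $G_i/G_{ij}G_{ik}$. -}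

module Defs where

open import Data.Nat using (ℕ)
open import Data.Fin using (Fin; _≟_)
open import Data.Fin.Subset using (Subset; _∈_)
open import Data.List using (length; filter; allFin)
open import Data.Product using (Σ; ∃; ∃₂; _×_; _,_)
open import Relation.Nullary.Decidable using (_×-dec_)
open import Relation.Binary.PropositionalEquality using (_≡_)
open import Algebra.Core using (Op₁; Op₂)
open import Algebra.Structures using (IsGroup)
open import Function.Bundles using (_⇔_; _↔_; Inverse)

-- Finite groups: a group structure (library `IsGroup`) on Fin order.
-- (Every finite group is isomorphic to one of these.)

record FinGroup : Set where
  field
    order   : ℕ
    _∙_     : Op₂ (Fin order)
    ε       : Fin order
    _⁻¹     : Op₁ (Fin order)
    isGroup : IsGroup _≡_ _∙_ ε _⁻¹

Elt : FinGroup → Set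
Elt G = Fin (FinGroup.order G)

mul : (G : FinGroup) → Elt G → Elt G → Elt G
mul G = FinGroup._∙_ G

module _ (G : FinGroup) where
  open FinGroup G

  record IsNormalSubgroup (H : Subset order) : Set where
    field
      ε-mem   : ε ∈ H
      ∙-mem   : ∀ x y → x ∈ H → y ∈ H → (x ∙ y) ∈ H
      ⁻¹-mem  : ∀ x → x ∈ H → (x ⁻¹) ∈ H
      conj-mem : ∀ g x → x ∈ H → ((g ∙ x) ∙ (g ⁻¹)) ∈ H

  CosetEq : Subset order → Fin order → Fin order → Set
  CosetEq H x y = (x ∙ (y ⁻¹)) ∈ H

  InProd : Subset order → Subset order → Fin order → Set
  InProd H K x = ∃₂ λ a b → a ∈ H × b ∈ K × x ≡ a ∙ b

  CosetEqProd : Subset order → Subset order → Fin order → Fin order → Set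
  CosetEqProd H K x y = InProd H K (x ∙ (y ⁻¹))

-- Systems of linked quotients based on {G i}_{i : Fin m}.
-- The isomorphism f_ij : G_i/G_ij → G_j/G_ji is represented by a map on
-- representatives F i j, well defined on cosets.

record LinkedQuotients {m : ℕ} (G : Fin m → FinGroup) : Set where
  field
    N        : (i j : Fin m) → Subset (FinGroup.order (G i))
    F        : (i j : Fin m) → Elt (G i) → Elt (G j)
    N-normal : ∀ i j → IsNormalSubgroup (G i) (N i j)
    N-diag   : ∀ i (x : Elt (G i)) → (x ∈ N i i) ⇔ (x ≡ FinGroup.ε (G i))
    F-wd     : ∀ i j x y → CosetEq (G i) (N i j) x y →
                 CosetEq (G j) (N j i) (F i j x) (F i j y)
    F-hom    : ∀ i j x y → CosetEq (G j) (N j i) (F i j (mul (G i) x y))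
                                                  (mul (G j) (F i j x) (F i j y))
    F-diag   : ∀ i x → CosetEq (G i) (N i i) (F i i x) x
    F-inv    : ∀ i j x → CosetEq (G i) (N i j) (F j i (F i j x)) x
    F-into   : ∀ i j k x → InProd (G i) (N i j) (N i k) x →
                 InProd (G k) (N k i) (N k j) (F i k x)
    F-onto   : ∀ i j k y → InProd (G k) (N k i) (N k j) y →
                 ∃ λ x → InProd (G i) (N i j) (N i k) x × CosetEq (G k) (N k i) (F i k x) y
    F-cycle  : ∀ i j k x →
                 CosetEqProd (G i) (N i j) (N i k) (F j i (F k j (F i k x))) x

-- Coherent configurations on Ω = Fin n with basis relations indexed by
-- Fin k; col a b is the basis relation containing (a , b).

record CC : Set where
  field
    n k    : ℕ
    col    : Fin n → Fin n → Fin k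
    col-onto : ∀ r → ∃₂ λ a b → col a b ≡ r
    -- 1_Ω is a union of basis relations
    diag   : ∀ a b b' → col a a ≡ col b b' → b ≡ b'
    transp : ∀ r → ∃ λ r' → ∀ a b → (col a b ≡ r) ⇔ (col b a ≡ r')
    inter  : ∀ r s a b a' b' → col a b ≡ col a' b' →
               length (filter (λ γ → (col a γ ≟ r) ×-dec (col γ b ≟ s)) (allFin n))
               ≡ length (filter (λ γ → (col a' γ ≟ r) ×-dec (col γ b' ≟ s)) (allFin n))

module _ (X : CC) where
  open CC X

  -- d is the basis relation 1_Δ of some fiber Δ = {a | col a a ≡ d}
  IsFiber : Fin k → Set
  IsFiber d = ∀ a b → col a b ≡ d → a ≡ b

  ContainedIn : Fin k → Fin k → Fin k → Set
  ContainedIn r d e = ∀ a b → col a b ≡ r → col a a ≡ d × col b b ≡ e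

  Thin : Fin k → Set
  Thin r = (∀ a b b' → col a b ≡ r → col a b' ≡ r → b ≡ b')
         × (∀ a a' b → col a b ≡ r → col a' b ≡ r → a ≡ a')

  Quasiregular : Set
  Quasiregular = ∀ d → IsFiber d → ∀ r → ContainedIn r d d → Thin r

  _∈_·_ : Fin k → Fin k → Fin k → Set
  t ∈ r · s = ∀ a b → col a b ≡ t → ∃ λ γ → col a γ ≡ r × col γ b ≡ s

  SetProd : (Fin k → Set) → (Fin k → Set) → Fin k → Set
  SetProd A B t = ∃₂ λ r s → A r × B s × t ∈ r · s

  Star : Fin k → Fin k → Set
  Star s r = ∀ a b → (col a b ≡ r) ⇔ (col b a ≡ s)

-- X is of type 𝔊: fibers indexed by Fin m, and φ i is an isomorphism of
-- G i onto the group of basis relations contained in Ω_i × Ω_i.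
record TypeG (X : CC) {m : ℕ} (G : Fin m → FinGroup) : Set where
  open CC X
  field
    fib        : Fin m → Fin k
    fib-fiber  : ∀ i → IsFiber X (fib i)
    fib-inj    : ∀ i j → fib i ≡ fib j → i ≡ j
    fib-onto   : ∀ d → IsFiber X d → ∃ λ i → fib i ≡ d
    φ          : (i : Fin m) → Elt (G i) → Fin k
    φ-in       : ∀ i g → ContainedIn X (φ i g) (fib i) (fib i)
    φ-onto     : ∀ i r → ContainedIn X r (fib i) (fib i) → ∃ λ g → φ i g ≡ r
    φ-inj      : ∀ i g h → φ i g ≡ φ i h → g ≡ h
    φ-hom      : ∀ i g h t → (_∈_·_ X t (φ i g) (φ i h)) ⇔ (t ≡ φ i (mul (G i) g h))

record QCfg {m : ℕ} (G : Fin m → FinGroup) : Set where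
  field
    cc    : CC
    quasi : Quasiregular cc
    typ   : TypeG cc G

module _ {m : ℕ} {G : Fin m → FinGroup} (𝒳 : QCfg G) where
  open QCfg 𝒳
  open CC cc
  open TypeG typ

  BasePoints : Set
  BasePoints = (i : Fin m) → Σ (Fin n) λ a → col a a ≡ fib i

  -- 𝒯(𝒳) computed at the base points α equals the system L
  Realizes : BasePoints → LinkedQuotients G → Set
  Realizes α L = (∀ i j g → (g ∈ N i j) ⇔ Gsub i j g)
               × (∀ i j g t → Image i j g t ⇔ Coset j i (F i j g) t)
    where
    open LinkedQuotients L
    pt : Fin m → Fin n
    pt i with α i
    ... | (a , _) = a
    s : Fin m → Fin m → Fin k
    s i j = col (pt i) (pt j)
    -- G_ij = s_ij s_ij*, viewed inside G_i via φ_i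
    Gsub : (i j : Fin m) → Elt (G i) → Set
    Gsub i j g = SetProd cc (_≡ s i j) (Star cc (s i j)) (φ i g)
    Coset : (i j : Fin m) → Elt (G i) → Fin k → Set
    Coset i j g t = ∃ λ x → Gsub i j x × t ≡ φ i (mul (G i) x g)
    Image : (i j : Fin m) → Elt (G i) → Fin k → Set
    Image i j g = SetProd cc (Star cc (s i j)) (SetProd cc (Coset i j g) (_≡ s i j))

record Iso {m : ℕ} {G : Fin m → FinGroup} (𝒳 𝒴 : QCfg G) : Set where
  private
    module X = CC (QCfg.cc 𝒳)
    module Y = CC (QCfg.cc 𝒴)
    module TX = TypeG (QCfg.typ 𝒳)
    module TY = TypeG (QCfg.typ 𝒴)
  field
    σ      : Fin X.n ↔ Fin Y.n
  σf : Fin X.n → Fin Y.n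
  σf = Inverse.to σ
  field
    pres   : ∀ a b a' b' → (X.col a b ≡ X.col a' b') ⇔ (Y.col (σf a) (σf b) ≡ Y.col (σf a') (σf b'))
    compat : ∀ i g a b → X.col a b ≡ TX.φ i g → Y.col (σf a) (σf b) ≡ TY.φ i g

-- Choosing base points α_i identifies each fibre Ω_i with G_i: since the configuration is
-- quasiregular, α_i g is the unique point β with (α_i, β) ∈ φ_i(g).  In these coordinates
-- (α_i x, α_j y) and (α_i x′, α_j y′) have the same colour iff (x x′⁻¹, y y′⁻¹) lies in
--   R_ij = {(x, y) | (α_i x, α_j y) ∈ s_ij} ≤ G_i × G_j,
-- so the configuration is determined by the family (R_ij).  This family is linked: R_ij projects
-- onto G_i, R_ii is the diagonal, R_ji is the transpose of R_ij, and R_ij ⊆ R_ik R_kj because,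
-- by the intersection numbers, the path α_i → α_k → α_j transfers to every pair of colour s_ij.
-- Conversely every linked family comes from the configuration on ⊔ G_i whose colours are its
-- cosets.  Goursat's lemma identifies linked families with systems of linked quotients, via
-- G_ij = {g | (g, 1) ∈ R_ij} and f_ij(G_ij x) = G_ji y for (x, y) ∈ R_ij; under it the condition
-- R_ij ⊆ R_ik R_kj becomes the cycle condition f_jki f_kij f_ijk = id.

module Submission where

open import Defs
open import Data.Nat using (ℕ; zero; suc; _<_)
open import Data.Nat.Properties using (+-0-commutativeMonoid)
open import Data.Fin using (Fin; zero; suc; _≟_)
open import Data.Fin.Properties using (any?; suc-injective; +↔⊎; *↔×)
open import Data.Fin.Permutation using (Permutation′; _⟨$⟩ʳ_)
open import Data.Fin.Subset using (Subset; _∈_)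
open import Data.Fin.Subset.Properties using (_∈?_)
open import Data.Bool using (if_then_else_)
open import Data.Bool.Properties using (T-≡)
open import Data.List using (List; _∷_; length; filter; tabulate; allFin)
open import Data.List.Properties using (filter-some)
open import Data.List.Membership.Propositional using (lose) renaming (_∈_ to _∈ₗ_)
open import Data.List.Membership.Propositional.Properties using (∈-allFin; ∈-filter⁻)
open import Data.List.Relation.Unary.Any using (here)
import Data.Vec as Vec
open import Data.Vec.Properties using (lookup⇒[]=; []=⇒lookup; lookup∘tabulate)
open import Data.Sum using (_⊎_; inj₁; inj₂)
open import Data.Sum.Function.Propositional using (_⊎-↔_)
open import Data.Product using (Σ; ∃; _×_; _,_; proj₁; proj₂; map₂)
open import Data.Product.Function.NonDependent.Propositional using (_×-↔_)
open import Function using (_∘_; _⇔_; mk⇔; Equivalence; _↔_; mk↔ₛ′; Inverse)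
import Function.Properties.Equivalence as ⇔
open import Function.Properties.Equivalence using (⇔-setoid)
open import Function.Properties.Inverse using (↔-refl; ↔-sym; ↔-trans)
open import Level using (0ℓ)
open import Relation.Nullary using (Dec; ¬_; does; yes; no; contradiction)
open import Relation.Nullary.Decidable using (_×-dec_; isYes; toWitness; fromWitness)
open import Relation.Unary using (Pred; Decidable)
open import Relation.Binary using (Rel; IsDecEquivalence)
import Relation.Binary.Construct.On as On
import Relation.Binary.Reasoning.Setoid as ≈-Reasoning
open import Relation.Binary.PropositionalEquality using (_≡_; refl; sym; trans; cong; cong₂; subst; subst₂; module ≡-Reasoning)
open import Algebra.Bundles using (Group)
import Algebra.Properties.Group as GroupProperties
import Algebra.Properties.Loop as LoopProperties
open import Algebra.Properties.CommutativeMonoid.Sum +-0-commutativeMonoid using (sum; sum-permute; sum-cong-≗)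

-- Counting and finite quotients

nonempty-member : ∀ {A : Set} {xs : List A} → 0 < length xs → ∃ (_∈ₗ xs)
nonempty-member {xs = x ∷ _} _ = x , here refl

count : ∀ {n} {P : Pred (Fin n) 0ℓ} → Decidable P → ℕ
count {n} P? = length (filter P? (allFin n))

module _ {n : ℕ} {P : Pred (Fin n) 0ℓ} (P? : Decidable P) where

  ∃⇒0<count : ∀ {x} → P x → 0 < count P?
  ∃⇒0<count {x} px = filter-some P? (lose (∈-allFin x) px)

  0<count⇒∃ : 0 < count P? → ∃ P
  0<count⇒∃ pos with x , x∈ ← nonempty-member pos = x , proj₂ (∈-filter⁻ P? {xs = allFin n} x∈)

indicator : ∀ {A : Set} {P : Pred A 0ℓ} → Decidable P → A → ℕ
indicator P? x = if does (P? x) then 1 else 0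

length-filter-tabulate : ∀ {A : Set} {P : Pred A 0ℓ} (P? : Decidable P) n (f : Fin n → A) →
                         length (filter P? (tabulate f)) ≡ sum (indicator P? ∘ f)
length-filter-tabulate P? zero    f = refl
length-filter-tabulate P? (suc n) f with P? (f Fin.zero)
... | yes _ = cong suc (length-filter-tabulate P? n (f ∘ Fin.suc))
... | no  _ = length-filter-tabulate P? n (f ∘ Fin.suc)

indicator-cong : ∀ {A B : Set} {P : Pred A 0ℓ} {Q : Pred B 0ℓ} (P? : Decidable P) (Q? : Decidable Q) {x y} →
                 P x ⇔ Q y → indicator P? x ≡ indicator Q? y
indicator-cong P? Q? {x} {y} p⇔q with P? x | Q? y
... | yes _ | yes _ = refl
... | no  _ | no  _ = refl
... | yes p | no ¬q = contradiction (Equivalence.to p⇔q p) ¬q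
... | no ¬p | yes q = contradiction (Equivalence.from p⇔q q) ¬p

count-permute : ∀ {n} {P Q : Pred (Fin n) 0ℓ} (P? : Decidable P) (Q? : Decidable Q) (π : Permutation′ n) →
                (∀ x → P x ⇔ Q (π ⟨$⟩ʳ x)) → count P? ≡ count Q?
count-permute {n} P? Q? π P⇔Qπ = begin
  count P?                              ≡⟨ length-filter-tabulate P? n (λ x → x) ⟩
  sum (indicator P?)                    ≡⟨ sum-cong-≗ (λ x → indicator-cong P? Q? (P⇔Qπ x)) ⟩
  sum (indicator Q? ∘ (π ⟨$⟩ʳ_))        ≡⟨ sym (sum-permute (indicator Q?) π) ⟩
  sum (indicator Q?)                    ≡⟨ sym (length-filter-tabulate Q? n (λ x → x)) ⟩
  count Q?                              ∎
  where open ≡-Reasoning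

Σ-Fin↔Fin-sum : ∀ {m} (o : Fin m → ℕ) → Σ (Fin m) (Fin ∘ o) ↔ Fin (sum o)
Σ-Fin↔Fin-sum {zero}  o = mk↔ₛ′ (λ ()) (λ ()) (λ ()) (λ ())
Σ-Fin↔Fin-sum {suc m} o = ↔-trans split (↔-trans (↔-refl ⊎-↔ Σ-Fin↔Fin-sum (o ∘ suc)) (↔-sym +↔⊎))
  where
  split : Σ (Fin (suc m)) (Fin ∘ o) ↔ (Fin (o zero) ⊎ Σ (Fin m) (Fin ∘ o ∘ suc))
  split = mk↔ₛ′ (λ { (zero , x) → inj₁ x ; (suc i , x) → inj₂ (i , x) })
                (λ { (inj₁ x) → zero , x ; (inj₂ (i , x)) → suc i , x })
                (λ { (inj₁ x) → refl ; (inj₂ (i , x)) → refl })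
                (λ { (zero , x) → refl ; (suc i , x) → refl })

record FinQuotient {A : Set} (_≈_ : Rel A 0ℓ) : Set where
  field
    size     : ℕ
    classify : A → Fin size
    classify-resp    : ∀ {a b} → a ≈ b → classify a ≡ classify b
    classify-reflect : ∀ {a b} → classify a ≡ classify b → a ≈ b
    classify-onto    : ∀ c → ∃ λ a → classify a ≡ c

module ExtendFinQuotient {N} {_≈_ : Rel (Fin (suc N)) 0ℓ} (≈-isDecEq : IsDecEquivalence _≈_)
                         (Q : FinQuotient (λ a b → suc a ≈ suc b)) where
  open IsDecEquivalence ≈-isDecEq using () renaming (refl to ≈-refl; sym to ≈-sym; trans to ≈-trans)
  open FinQuotient Q

  byJoining : ∀ y → zero ≈ suc y → FinQuotient _≈_
  byJoining y 0≈y = record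
    { size = size ; classify = classify′ ; classify-resp = resp ; classify-reflect = reflect
    ; classify-onto = λ c → suc (proj₁ (classify-onto c)) , proj₂ (classify-onto c) }
    where
    classify′ : Fin (suc N) → Fin size
    classify′ zero    = classify y
    classify′ (suc a) = classify a
    resp : ∀ {a b} → a ≈ b → classify′ a ≡ classify′ b
    resp {zero}  {zero}  _   = refl
    resp {zero}  {suc b} 0≈b = classify-resp (≈-trans (≈-sym 0≈y) 0≈b)
    resp {suc a} {zero}  a≈0 = classify-resp (≈-trans a≈0 0≈y)
    resp {suc a} {suc b} a≈b = classify-resp a≈b
    reflect : ∀ {a b} → classify′ a ≡ classify′ b → a ≈ b
    reflect {zero}  {zero}  _ = ≈-refl
    reflect {zero}  {suc b} e = ≈-trans 0≈y (classify-reflect e)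
    reflect {suc a} {zero}  e = ≈-trans (classify-reflect e) (≈-sym 0≈y)
    reflect {suc a} {suc b} e = classify-reflect e

  byNewClass : (∀ y → ¬ zero ≈ suc y) → FinQuotient _≈_
  byNewClass 0≉suc = record
    { size = suc size ; classify = classify′ ; classify-resp = resp ; classify-reflect = reflect
    ; classify-onto = onto }
    where
    classify′ : Fin (suc N) → Fin (suc size)
    classify′ zero    = zero
    classify′ (suc a) = suc (classify a)
    resp : ∀ {a b} → a ≈ b → classify′ a ≡ classify′ b
    resp {zero}  {zero}  _   = refl
    resp {zero}  {suc b} 0≈b = contradiction 0≈b (0≉suc b)
    resp {suc a} {zero}  a≈0 = contradiction (≈-sym a≈0) (0≉suc a)
    resp {suc a} {suc b} a≈b = cong suc (classify-resp a≈b)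
    reflect : ∀ {a b} → classify′ a ≡ classify′ b → a ≈ b
    reflect {zero}  {zero}  _ = ≈-refl
    reflect {suc a} {suc b} e = classify-reflect (suc-injective e)
    onto : ∀ c → ∃ λ a → classify′ a ≡ c
    onto zero    = zero , refl
    onto (suc c) = suc (proj₁ (classify-onto c)) , cong suc (proj₂ (classify-onto c))

finQuotient : ∀ {N} {_≈_ : Rel (Fin N) 0ℓ} → IsDecEquivalence _≈_ → FinQuotient _≈_
finQuotient {zero} _ = record
  { size = 0 ; classify = λ () ; classify-resp = λ {} ; classify-reflect = λ {} ; classify-onto = λ () }
finQuotient {suc N} ≈-isDecEq with any? (λ y → IsDecEquivalence._≟_ ≈-isDecEq zero (suc y))
... | yes (y , 0≈y) = ExtendFinQuotient.byJoining ≈-isDecEq (finQuotient (On.isDecEquivalence suc ≈-isDecEq)) y 0≈y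
... | no 0≉suc     = ExtendFinQuotient.byNewClass ≈-isDecEq (finQuotient (On.isDecEquivalence suc ≈-isDecEq))
                       (λ y 0≈y → 0≉suc (y , 0≈y))

finQuotient-↔ : ∀ {A : Set} {N} {_≈_ : Rel A 0ℓ} → A ↔ Fin N → IsDecEquivalence _≈_ → FinQuotient _≈_
finQuotient-↔ {_≈_ = _≈_} A↔Fin ≈-isDecEq = record
  { size = size
  ; classify = classify ∘ to
  ; classify-resp = λ {a} {b} a≈b → classify-resp (subst₂ _≈_ (sym (strictlyInverseʳ a)) (sym (strictlyInverseʳ b)) a≈b)
  ; classify-reflect = λ {a} {b} e → subst₂ _≈_ (strictlyInverseʳ a) (strictlyInverseʳ b) (classify-reflect e)
  ; classify-onto = λ c → from (proj₁ (classify-onto c)) ,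
                          trans (cong classify (strictlyInverseˡ _)) (proj₂ (classify-onto c))
  }
  where
  open Inverse A↔Fin
  open FinQuotient (finQuotient (On.isDecEquivalence from ≈-isDecEq))

-- Groups and normal subgroups

module _ {n : ℕ} {P : Pred (Fin n) 0ℓ} (P? : Decidable P) where

  toSubset : Subset n
  toSubset = Vec.tabulate (isYes ∘ P?)

  ∈-toSubset⁺ : ∀ {x} → P x → x ∈ toSubset
  ∈-toSubset⁺ {x} px = lookup⇒[]= x toSubset
    (trans (lookup∘tabulate (isYes ∘ P?) x) (Equivalence.to T-≡ (fromWitness {a? = P? x} px)))

  ∈-toSubset⁻ : ∀ {x} → x ∈ toSubset → P x
  ∈-toSubset⁻ {x} x∈ = toWitness {a? = P? x} (Equivalence.from T-≡
    (trans (sym (lookup∘tabulate (isYes ∘ P?) x)) ([]=⇒lookup x∈)))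

group : FinGroup → Group 0ℓ 0ℓ
group G = record { isGroup = FinGroup.isGroup G }

module FinGroupProperties (G : FinGroup) where
  open Group (group G) public using (_∙_; ε; _⁻¹; _//_; _\\_; assoc; identityˡ; identityʳ; inverseˡ; inverseʳ)
  open GroupProperties (group G) public
  open LoopProperties loop public using (ε\\x≈x; x//ε≈x)

  //-chain : ∀ x y z → (x // y) ∙ (y // z) ≡ x // z
  //-chain x y z = trans (assoc x (y ⁻¹) (y // z)) (cong (x ∙_) (\\-leftDividesʳ y (z ⁻¹)))

  \\-chain : ∀ x y z → (x \\ y) ∙ (y \\ z) ≡ x \\ z
  \\-chain x y z = trans (assoc (x ⁻¹) y (y \\ z)) (cong (x ⁻¹ ∙_) (\\-leftDividesˡ y z))

module NormalSubgroup {G : FinGroup} {H : Subset (FinGroup.order G)} (H-normal : IsNormalSubgroup G H) where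
  open FinGroupProperties G
  open IsNormalSubgroup H-normal public
  open ≡-Reasoning

  conj⁻¹-mem : ∀ g x → x ∈ H → (g ⁻¹ ∙ x) ∙ g ∈ H
  conj⁻¹-mem g x x∈H = subst (λ h → (g ⁻¹ ∙ x) ∙ h ∈ H) (⁻¹-involutive g) (conj-mem (g ⁻¹) x x∈H)

  infix 4 _≈_
  _≈_ : Fin (FinGroup.order G) → Fin (FinGroup.order G) → Set
  _≈_ = CosetEq G H

  ≈-refl : ∀ {x} → x ≈ x
  ≈-refl {x} = subst (_∈ H) (sym (inverseʳ x)) ε-mem

  ≈-sym : ∀ {x y} → x ≈ y → y ≈ x
  ≈-sym {x} {y} x≈y = subst (_∈ H) (⁻¹-anti-homo-// x y) (⁻¹-mem _ x≈y)

  ≈-trans : ∀ {x y z} → x ≈ y → y ≈ z → x ≈ z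
  ≈-trans {x} {y} {z} x≈y y≈z = subst (_∈ H) (//-chain x y z) (∙-mem _ _ x≈y y≈z)

  ≈-∙ : ∀ {x x′ y y′} → x ≈ x′ → y ≈ y′ → x ∙ y ≈ x′ ∙ y′
  ≈-∙ {x} {x′} {y} {y′} x≈x′ y≈y′ = subst (_∈ H) eq (∙-mem _ _ (conj-mem x _ y≈y′) x≈x′)
    where
    eq : ((x ∙ (y // y′)) ∙ x ⁻¹) ∙ (x // x′) ≡ (x ∙ y) // (x′ ∙ y′)
    eq = begin
      ((x ∙ (y // y′)) ∙ x ⁻¹) ∙ (x // x′) ≡⟨ assoc _ _ _ ⟩
      (x ∙ (y // y′)) ∙ (x \\ (x // x′))   ≡⟨ cong ((x ∙ (y // y′)) ∙_) (\\-leftDividesʳ x _) ⟩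
      (x ∙ (y // y′)) ∙ x′ ⁻¹              ≡⟨ cong (_∙ x′ ⁻¹) (sym (assoc _ _ _)) ⟩
      ((x ∙ y) ∙ y′ ⁻¹) ∙ x′ ⁻¹            ≡⟨ assoc _ _ _ ⟩
      (x ∙ y) ∙ (y′ ⁻¹ ∙ x′ ⁻¹)            ≡⟨ cong ((x ∙ y) ∙_) (sym (⁻¹-anti-homo-∙ x′ y′)) ⟩
      (x ∙ y) // (x′ ∙ y′)                 ∎

  ≈-⁻¹ : ∀ {x y} → x ≈ y → x ⁻¹ ≈ y ⁻¹
  ≈-⁻¹ {x} {y} x≈y = subst (_∈ H) eq (conj⁻¹-mem x _ (≈-sym x≈y))
    where
    eq : (x ⁻¹ ∙ (y // x)) ∙ x ≡ x ⁻¹ // y ⁻¹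
    eq = trans (assoc _ _ _) (cong (x ⁻¹ ∙_) (trans (//-rightDividesˡ x y) (sym (⁻¹-involutive y))))

  ∈⇒≈ε : ∀ {x} → x ∈ H → x ≈ ε
  ∈⇒≈ε {x} = subst (_∈ H) (trans (sym (identityʳ x)) (cong (x ∙_) (sym ε⁻¹≈ε)))

  ≈ε⇒∈ : ∀ {x} → x ≈ ε → x ∈ H
  ≈ε⇒∈ {x} = subst (_∈ H) (trans (cong (x ∙_) ε⁻¹≈ε) (identityʳ x))

  ∈⇒≈∙ˡ : ∀ {c x} → c ∈ H → x ≈ c ∙ x
  ∈⇒≈∙ˡ {c} {x} c∈H = subst (_≈ c ∙ x) (identityˡ x) (≈-∙ (≈-sym (∈⇒≈ε c∈H)) ≈-refl)

  ∈⇒≈∙ʳ : ∀ {d x} → d ∈ H → x ≈ x ∙ d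
  ∈⇒≈∙ʳ {d} {x} d∈H = subst (_≈ x ∙ d) (identityʳ x) (≈-∙ ≈-refl (≈-sym (∈⇒≈ε d∈H)))

  ≈⇒\\∈ : ∀ {x y} → x ≈ y → x \\ y ∈ H
  ≈⇒\\∈ {x} {y} x≈y = subst (_∈ H) (trans (assoc _ _ _) (cong (x ⁻¹ ∙_) (//-rightDividesˡ x y)))
                        (conj⁻¹-mem x _ (≈-sym x≈y))

module NormalProduct {G : FinGroup} {H K : Subset (FinGroup.order G)}
                     (H-normal : IsNormalSubgroup G H) (K-normal : IsNormalSubgroup G K) where
  open FinGroupProperties G
  private
    module H = NormalSubgroup H-normal
    module K = NormalSubgroup K-normal
  open ≡-Reasoning

  ∈⇒InProdˡ : ∀ {a} → a ∈ H → InProd G H K a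
  ∈⇒InProdˡ {a} a∈H = a , ε , a∈H , K.ε-mem , sym (identityʳ a)

  InProd-∙ : ∀ {x y} → InProd G H K x → InProd G H K y → InProd G H K (x ∙ y)
  InProd-∙ (a , b , a∈H , b∈K , refl) (c , d , c∈H , d∈K , refl) =
    a ∙ c , ((c ⁻¹ ∙ b) ∙ c) ∙ d , H.∙-mem _ _ a∈H c∈H , K.∙-mem _ _ (K.conj⁻¹-mem c b b∈K) d∈K , eq
    where
    eq : (a ∙ b) ∙ (c ∙ d) ≡ (a ∙ c) ∙ (((c ⁻¹ ∙ b) ∙ c) ∙ d)
    eq = begin
      (a ∙ b) ∙ (c ∙ d)                   ≡⟨ assoc _ _ _ ⟩
      a ∙ (b ∙ (c ∙ d))                   ≡⟨ cong (a ∙_) (sym (\\-leftDividesˡ c _)) ⟩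
      a ∙ (c ∙ (c ⁻¹ ∙ (b ∙ (c ∙ d))))    ≡⟨ sym (assoc _ _ _) ⟩
      (a ∙ c) ∙ (c ⁻¹ ∙ (b ∙ (c ∙ d)))    ≡⟨ cong (λ w → (a ∙ c) ∙ (c ⁻¹ ∙ w)) (sym (assoc _ _ _)) ⟩
      (a ∙ c) ∙ (c ⁻¹ ∙ ((b ∙ c) ∙ d))    ≡⟨ cong ((a ∙ c) ∙_) (sym (assoc _ _ _)) ⟩
      (a ∙ c) ∙ ((c ⁻¹ ∙ (b ∙ c)) ∙ d)    ≡⟨ cong (λ w → (a ∙ c) ∙ (w ∙ d)) (sym (assoc _ _ _)) ⟩
      (a ∙ c) ∙ (((c ⁻¹ ∙ b) ∙ c) ∙ d)    ∎

  InProd-comm : ∀ {x} → InProd G H K x → InProd G K H x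
  InProd-comm (a , b , a∈H , b∈K , refl) = b , (b ⁻¹ ∙ a) ∙ b , b∈K , H.conj⁻¹-mem b a a∈H , eq
    where
    eq : a ∙ b ≡ b ∙ ((b ⁻¹ ∙ a) ∙ b)
    eq = trans (sym (\\-leftDividesˡ b (a ∙ b))) (cong (b ∙_) (sym (assoc _ _ _)))

  CosetEqProd-trans : ∀ {x y z} → CosetEqProd G H K x y → CosetEqProd G H K y z → CosetEqProd G H K x z
  CosetEqProd-trans {x} {y} {z} x≈y y≈z = subst (InProd G H K) (//-chain x y z) (InProd-∙ x≈y y≈z)

-- Linked subgroups and Goursat's lemma

LinkedRel : ∀ {m} → (Fin m → FinGroup) → Set₁
LinkedRel {m} G = ∀ (i j : Fin m) → Elt (G i) → Elt (G j) → Set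

module Family {m : ℕ} (G : Fin m → FinGroup) where
  module Gᵢ (i : Fin m) = FinGroupProperties (G i)

  infixl 7 ∙-at //-at
  infix 8 ⁻¹-at

  ∙-at : ∀ i → Elt (G i) → Elt (G i) → Elt (G i)
  ∙-at i = Gᵢ._∙_ i
  syntax ∙-at i x y = x ∙⟨ i ⟩ y

  //-at : ∀ i → Elt (G i) → Elt (G i) → Elt (G i)
  //-at i = Gᵢ._//_ i
  syntax //-at i x y = x //⟨ i ⟩ y

  ⁻¹-at : ∀ i → Elt (G i) → Elt (G i)
  ⁻¹-at i = Gᵢ._⁻¹ i
  syntax ⁻¹-at i x = x ⁻¹⟨ i ⟩

  ε-at : ∀ i → Elt (G i)
  ε-at i = Gᵢ.ε i
  syntax ε-at i = ε⟨ i ⟩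

  _≐_ : LinkedRel G → LinkedRel G → Set
  R ≐ S = ∀ i j x y → R i j x y ⇔ S i j x y

  ≐-sym : ∀ {R S} → R ≐ S → S ≐ R
  ≐-sym R≐S i j x y = ⇔.sym (R≐S i j x y)

  ≐-trans : ∀ {R S T} → R ≐ S → S ≐ T → R ≐ T
  ≐-trans R≐S S≐T i j x y = ⇔.trans (R≐S i j x y) (S≐T i j x y)

  Point : Set
  Point = Σ (Fin m) (λ i → Elt (G i))

  data SameColour (R : LinkedRel G) : Point → Point → Point → Point → Set where
    same : ∀ {i j x y x′ y′} → R i j (x //⟨ i ⟩ x′) (y //⟨ j ⟩ y′) →
           SameColour R (i , x) (j , y) (i , x′) (j , y′)

  SameColour-map : ∀ {R S : LinkedRel G} → (∀ {i j x y} → R i j x y → S i j x y) →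
                   ∀ {p q p′ q′} → SameColour R p q p′ q′ → SameColour S p q p′ q′
  SameColour-map R⇒S (same r) = same (R⇒S r)

  data Translate (i : Fin m) (g : Elt (G i)) : Point → Point → Set where
    translate : ∀ {x y} → x ⁻¹⟨ i ⟩ ∙⟨ i ⟩ y ≡ g → Translate i g (i , x) (i , y)

record LinkedSubgroups {m : ℕ} (G : Fin m → FinGroup) : Set₁ where
  open Family G
  field
    R       : LinkedRel G
    R?      : ∀ i j x y → Dec (R i j x y)
    R-∙     : ∀ {i j x y x′ y′} → R i j x y → R i j x′ y′ → R i j (x ∙⟨ i ⟩ x′) (y ∙⟨ j ⟩ y′)
    R-⁻¹    : ∀ {i j x y} → R i j x y → R i j (x ⁻¹⟨ i ⟩) (y ⁻¹⟨ j ⟩)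
    R-total : ∀ i j x → ∃ (R i j x)
    R-diag  : ∀ {i x y} → R i i x y → x ≡ y
    R-sym   : ∀ {i j x y} → R i j x y → R j i y x
    R-split : ∀ {i j} k {x y} → R i j x y → ∃ λ z → R i k x z × R k j z y

  R-// : ∀ {i j x y x′ y′} → R i j x y → R i j x′ y′ → R i j (x //⟨ i ⟩ x′) (y //⟨ j ⟩ y′)
  R-// r r′ = R-∙ r (R-⁻¹ r′)

  R-ε : ∀ i j → R i j ε⟨ i ⟩ ε⟨ j ⟩
  R-ε i j = let r = proj₂ (R-total i j ε⟨ i ⟩) in subst₂ (R i j) (Gᵢ.inverseʳ i _) (Gᵢ.inverseʳ j _) (R-// r r)

  R-refl : ∀ i x → R i i x x
  R-refl i x = let (y , r) = R-total i i x in subst (R i i x) (sym (R-diag r)) r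

Graph : ∀ {m} {G : Fin m → FinGroup} → LinkedQuotients G → LinkedRel G
Graph {G = G} L i j x y = CosetEq (G j) (N j i) (F i j x) y
  where open LinkedQuotients L

module FromLinkedSubgroups {m : ℕ} {G : Fin m → FinGroup} (Γ : LinkedSubgroups G) where
  open Family G
  open LinkedSubgroups Γ

  N : ∀ i j → Subset (FinGroup.order (G i))
  N i j = toSubset (λ g → R? i j g ε⟨ j ⟩)

  R⇒∈N : ∀ {i j g} → R i j g ε⟨ j ⟩ → g ∈ N i j
  R⇒∈N = ∈-toSubset⁺ _

  ∈N⇒R : ∀ {i j g} → g ∈ N i j → R i j g ε⟨ j ⟩
  ∈N⇒R = ∈-toSubset⁻ _

  ∈N⇒Rˢ : ∀ {i j g} → g ∈ N j i → R i j ε⟨ i ⟩ g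
  ∈N⇒Rˢ g∈N = R-sym (∈N⇒R g∈N)

  F : ∀ i j → Elt (G i) → Elt (G j)
  F i j x = proj₁ (R-total i j x)

  R-F : ∀ i j x → R i j x (F i j x)
  R-F i j x = proj₂ (R-total i j x)

  R⇒∈Nʳ : ∀ {i j x y y′} → R i j x y → R i j x y′ → y′ //⟨ j ⟩ y ∈ N j i
  R⇒∈Nʳ {i} {j} {x} {y} {y′} r r′ =
    R⇒∈N (R-sym (subst (λ u → R i j u (y′ //⟨ j ⟩ y)) (Gᵢ.inverseʳ i x) (R-// r′ r)))

  R⇒∈Nˡ : ∀ {i j x x′ y} → R i j x y → R i j x′ y → x //⟨ i ⟩ x′ ∈ N i j
  R⇒∈Nˡ {i} {j} {x} {x′} {y} r r′ = R⇒∈N (subst (R i j (x //⟨ i ⟩ x′)) (Gᵢ.inverseʳ j y) (R-// r r′))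

  N-normal : ∀ i j → IsNormalSubgroup (G i) (N i j)
  N-normal i j = record
    { ε-mem    = R⇒∈N (R-ε i j)
    ; ∙-mem    = λ _ _ x∈ y∈ → R⇒∈N (subst (R i j _) (Gᵢ.identityˡ j _) (R-∙ (∈N⇒R x∈) (∈N⇒R y∈)))
    ; ⁻¹-mem   = λ _ x∈ → R⇒∈N (subst (R i j _) (Gᵢ.ε⁻¹≈ε j) (R-⁻¹ (∈N⇒R x∈)))
    ; conj-mem = λ g _ x∈ → R⇒∈N (subst (R i j _) (conj-ε g) (R-∙ (R-∙ (R-F i j g) (∈N⇒R x∈)) (R-⁻¹ (R-F i j g))))
    }
    where
    conj-ε : ∀ g → (F i j g ∙⟨ j ⟩ ε⟨ j ⟩) //⟨ j ⟩ F i j g ≡ ε⟨ j ⟩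
    conj-ε g = trans (cong (λ u → u //⟨ j ⟩ F i j g) (Gᵢ.identityʳ j _)) (Gᵢ.inverseʳ j _)

  private
    module N (i j : Fin m) = NormalSubgroup (N-normal i j)
    module NN (i j k : Fin m) = NormalProduct (N-normal i j) (N-normal i k)

  F-into : ∀ i j k x → InProd (G i) (N i j) (N i k) x → InProd (G k) (N k i) (N k j) (F i k x)
  F-into i j k x (a , b , a∈ , b∈ , refl) =
    F i k x //⟨ k ⟩ z , z , R⇒∈Nʳ rz (R-F i k x) , R⇒∈N zj , sym (Gᵢ.//-rightDividesˡ k z _)
    where
    split = R-split k (∈N⇒R a∈)
    z = proj₁ split
    zj = proj₂ (proj₂ split)
    rz : R i k x z
    rz = subst (R i k x) (Gᵢ.identityʳ k z) (R-∙ (proj₁ (proj₂ split)) (∈N⇒R b∈))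

  F-onto : ∀ i j k y → InProd (G k) (N k i) (N k j) y →
           ∃ λ x → InProd (G i) (N i j) (N i k) x × CosetEq (G k) (N k i) (F i k x) y
  F-onto i j k y (c , d , c∈ , d∈ , refl) =
    w , NN.∈⇒InProdˡ i j k (R⇒∈N wj) , N.≈-trans k i (R⇒∈Nʳ (R-sym dw) (R-F i k w)) (N.∈⇒≈∙ˡ k i c∈)
    where
    split = R-split i (∈N⇒R d∈)
    w = proj₁ split
    dw = proj₁ (proj₂ split)
    wj = proj₂ (proj₂ split)

  F-cycle : ∀ i j k x → CosetEqProd (G i) (N i j) (N i k) (F j i (F k j (F i k x))) x
  F-cycle i j k x = v //⟨ i ⟩ u , (x //⟨ i ⟩ u) ⁻¹⟨ i ⟩ ,
                    R⇒∈Nˡ (R-sym (R-F j i _)) uw , N.⁻¹-mem i k _ (R⇒∈Nˡ (R-F i k x) (R-sym zu)) , sym eq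
    where
    split = R-split i (R-F k j (F i k x))
    u = proj₁ split
    zu = proj₁ (proj₂ split)
    uw = proj₂ (proj₂ split)
    v = F j i (F k j (F i k x))
    eq : (v //⟨ i ⟩ u) ∙⟨ i ⟩ ((x //⟨ i ⟩ u) ⁻¹⟨ i ⟩) ≡ v //⟨ i ⟩ x
    eq = trans (cong (λ g → (v //⟨ i ⟩ u) ∙⟨ i ⟩ g) (Gᵢ.⁻¹-anti-homo-// i x u)) (Gᵢ.//-chain i v u x)

  linkedQuotients : LinkedQuotients G
  linkedQuotients = record
    { N        = N
    ; F        = F
    ; N-normal = N-normal
    ; N-diag   = λ i x → mk⇔ (λ x∈ → R-diag (∈N⇒R x∈)) (λ { refl → R⇒∈N (R-refl i _) })
    ; F-wd     = λ i j x y x≈y → subst (_∈ N j i) (Gᵢ.x//ε≈x j _) (R⇒∈Nʳ (∈N⇒R x≈y) (R-// (R-F i j x) (R-F i j y)))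
    ; F-hom    = λ i j x y → R⇒∈Nʳ (R-∙ (R-F i j x) (R-F i j y)) (R-F i j _)
    ; F-diag   = λ i x → subst (λ u → CosetEq (G i) (N i i) u x) (R-diag (R-F i i x)) (N.≈-refl i i)
    ; F-inv    = λ i j x → R⇒∈Nˡ (R-sym (R-F j i (F i j x))) (R-F i j x)
    ; F-into   = F-into
    ; F-onto   = F-onto
    ; F-cycle  = F-cycle
    }

  R≐Graph : R ≐ Graph linkedQuotients
  R≐Graph i j x y = mk⇔ (λ r → R⇒∈Nʳ r (R-F i j x))
    (λ Fx≈y → subst₂ (R i j) (Gᵢ.identityˡ i x) (Gᵢ.//-rightDividesˡ j _ y)
                 (R-∙ (∈N⇒Rˢ (N.≈-sym j i Fx≈y)) (R-F i j x)))

module FromLinkedQuotients {m : ℕ} {G : Fin m → FinGroup} (L : LinkedQuotients G) where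
  open Family G
  open LinkedQuotients L
  private
    module N (i j : Fin m) = NormalSubgroup (N-normal i j)
    module NN (i j k : Fin m) = NormalProduct (N-normal i j) (N-normal i k)

  F-ε : ∀ i j → F i j ε⟨ i ⟩ ∈ N j i
  F-ε i j = subst (_∈ N j i) (Gᵢ.\\-leftDividesʳ j e e) (N.≈⇒\\∈ j i e≈e∙e)
    where
    e = F i j ε⟨ i ⟩
    e≈e∙e : CosetEq (G j) (N j i) e (e ∙⟨ j ⟩ e)
    e≈e∙e = subst (λ u → CosetEq (G j) (N j i) (F i j u) (e ∙⟨ j ⟩ e)) (Gᵢ.identityˡ i _)
                  (F-hom i j ε⟨ i ⟩ ε⟨ i ⟩)

  F-⁻¹ : ∀ i j x → CosetEq (G j) (N j i) (F i j (x ⁻¹⟨ i ⟩)) (F i j x ⁻¹⟨ j ⟩)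
  F-⁻¹ i j x = subst₂ (CosetEq (G j) (N j i)) (Gᵢ.//-rightDividesʳ j b a) (Gᵢ.identityˡ j _)
                 (N.≈-∙ j i a∙b≈ε (N.≈-refl j i))
    where
    a = F i j (x ⁻¹⟨ i ⟩)
    b = F i j x
    a∙b≈ε : CosetEq (G j) (N j i) (a ∙⟨ j ⟩ b) ε⟨ j ⟩
    a∙b≈ε = N.≈-trans j i (N.≈-sym j i (F-hom i j _ x))
              (subst (λ u → CosetEq (G j) (N j i) (F i j u) ε⟨ j ⟩) (sym (Gᵢ.inverseˡ i x)) (N.∈⇒≈ε j i (F-ε i j)))

  F-// : ∀ i j k a b → CosetEqProd (G i) (N i j) (N i k) a b → CosetEqProd (G j) (N j i) (N j k) (F i j a) (F i j b)
  F-// i j k a b a≈b = subst (InProd (G j) (N j i) (N j k)) eq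
                         (NN.InProd-∙ j i k (NN.∈⇒InProdˡ j i k Fa≈Fc∙Fb) (F-into i k j c (NN.InProd-comm i j k a≈b)))
    where
    open ≡-Reasoning
    c = a //⟨ i ⟩ b
    Fa≈Fc∙Fb : CosetEq (G j) (N j i) (F i j a) (F i j c ∙⟨ j ⟩ F i j b)
    Fa≈Fc∙Fb = subst (λ u → CosetEq (G j) (N j i) (F i j u) (F i j c ∙⟨ j ⟩ F i j b))
                     (Gᵢ.//-rightDividesˡ i b a) (F-hom i j c b)
    eq : (F i j a //⟨ j ⟩ (F i j c ∙⟨ j ⟩ F i j b)) ∙⟨ j ⟩ F i j c ≡ F i j a //⟨ j ⟩ F i j b
    eq = begin
      (F i j a //⟨ j ⟩ (F i j c ∙⟨ j ⟩ F i j b)) ∙⟨ j ⟩ F i j c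
        ≡⟨ Gᵢ.assoc j _ _ _ ⟩
      F i j a ∙⟨ j ⟩ ((F i j c ∙⟨ j ⟩ F i j b) ⁻¹⟨ j ⟩ ∙⟨ j ⟩ F i j c)
        ≡⟨ cong (λ u → F i j a ∙⟨ j ⟩ (u ∙⟨ j ⟩ F i j c)) (Gᵢ.⁻¹-anti-homo-∙ j _ _) ⟩
      F i j a ∙⟨ j ⟩ ((F i j b ⁻¹⟨ j ⟩ //⟨ j ⟩ F i j c) ∙⟨ j ⟩ F i j c)
        ≡⟨ cong (λ u → F i j a ∙⟨ j ⟩ u) (Gᵢ.//-rightDividesˡ j _ _) ⟩
      F i j a //⟨ j ⟩ F i j b
        ∎

  F-triangle : ∀ i j k x → CosetEqProd (G j) (N j i) (N j k) (F k j (F i k x)) (F i j x)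
  F-triangle i j k x = NN.CosetEqProd-trans j i k (NN.∈⇒InProdˡ j i k (N.≈-sym j i (F-inv j i w)))
                                                  (F-// i j k _ x (F-cycle i j k x))
    where w = F k j (F i k x)

  N-lift : ∀ i j k b → b ∈ N j i → ∃ λ c → c ∈ N k i × CosetEq (G j) (N j k) (F k j c) b
  N-lift i j k b b∈ with F-onto k i j b (NN.InProd-comm j i k (NN.∈⇒InProdˡ j i k b∈))
  ... | _ , (c , d , c∈ , d∈ , refl) , Fcd≈b = c , c∈ , N.≈-trans j k (F-wd k j _ _ (N.∈⇒≈∙ʳ k j d∈)) Fcd≈b

  Graph-split : ∀ {i j} k {x y} → Graph L i j x y → ∃ λ z → Graph L i k x z × Graph L k j z y
  Graph-split {i} {j} k {x} {y} Fx≈y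
    with NN.CosetEqProd-trans j i k (F-triangle i j k x) (NN.∈⇒InProdˡ j i k Fx≈y)
  ... | b , a , b∈ , a∈ , w//y≡b∙a
    with N-lift i j k (b ⁻¹⟨ j ⟩) (N.⁻¹-mem j i b b∈)
  ... | c , c∈ , Fc≈b⁻¹ = c ∙⟨ k ⟩ z₀ , N.∈⇒≈∙ˡ k i c∈ ,
                          N.≈-trans j k (F-hom k j c z₀) (N.≈-trans j k (N.≈-∙ j k Fc≈b⁻¹ (N.≈-refl j k)) b⁻¹∙w≈y)
    where
    open ≡-Reasoning
    z₀ = F i k x
    w = F k j z₀
    b⁻¹∙w≈y : CosetEq (G j) (N j k) (b ⁻¹⟨ j ⟩ ∙⟨ j ⟩ w) y
    b⁻¹∙w≈y = subst (_∈ N j k) eq a∈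
      where
      eq : a ≡ (b ⁻¹⟨ j ⟩ ∙⟨ j ⟩ w) //⟨ j ⟩ y
      eq = begin
        a                                  ≡⟨ Gᵢ.\\-leftDividesʳ j b a ⟨
        b ⁻¹⟨ j ⟩ ∙⟨ j ⟩ (b ∙⟨ j ⟩ a)      ≡⟨ cong (λ u → b ⁻¹⟨ j ⟩ ∙⟨ j ⟩ u) w//y≡b∙a ⟨
        b ⁻¹⟨ j ⟩ ∙⟨ j ⟩ (w //⟨ j ⟩ y)     ≡⟨ Gᵢ.assoc j _ _ _ ⟨
        (b ⁻¹⟨ j ⟩ ∙⟨ j ⟩ w) //⟨ j ⟩ y     ∎

  Graph-diag : ∀ {i x y} → Graph L i i x y → x ≡ y
  Graph-diag {i} {x} {y} Fx≈y = Gᵢ.x∙y⁻¹≈ε⇒x≈y i x y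
    (Equivalence.to (N-diag i _) (N.≈-trans i i (N.≈-sym i i (F-diag i x)) Fx≈y))

  linkedSubgroups : LinkedSubgroups G
  linkedSubgroups = record
    { R       = Graph L
    ; R?      = λ i j x y → _ ∈? _
    ; R-∙     = λ {i} {j} {x} {_} {x′} r r′ → N.≈-trans j i (F-hom i j x x′) (N.≈-∙ j i r r′)
    ; R-⁻¹    = λ {i} {j} {x} r → N.≈-trans j i (F-⁻¹ i j x) (N.≈-⁻¹ j i r)
    ; R-total = λ i j x → F i j x , N.≈-refl j i
    ; R-diag  = Graph-diag
    ; R-sym   = λ {i} {j} {x} r → N.≈-trans i j (N.≈-sym i j (F-wd j i _ _ r)) (F-inv i j x)
    ; R-split = Graph-split
    }

  ∈N⇔Graph : ∀ i j g → g ∈ N i j ⇔ Graph L i j g ε⟨ j ⟩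
  ∈N⇔Graph i j g = mk⇔
    (λ g∈ → N.≈-trans j i (F-wd i j g _ (N.∈⇒≈ε i j g∈)) (N.∈⇒≈ε j i (F-ε i j)))
    (λ Fg≈ε → N.≈ε⇒∈ i j (N.≈-trans i j (N.≈-sym i j (F-inv i j g))
                 (N.≈-trans i j (F-wd j i _ _ Fg≈ε) (N.∈⇒≈ε i j (F-ε j i)))))

-- Coordinates in a quasiregular configuration

module CCProperties (X : CC) where
  open CC X

  -- The only use of the intersection numbers.  Kept abstract: unfolding the count makes
  -- later unification problems explode.
  abstract
   ∈·-intro : ∀ {a b γ t r s} → col a b ≡ t → col a γ ≡ r → col γ b ≡ s → _∈_·_ X t r s
   ∈·-intro {a} {b} {γ} {t} {r} {s} ab≡t aγ≡r γb≡s a′ b′ a′b′≡t =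
     0<count⇒∃ (λ γ → (col a′ γ ≟ r) ×-dec (col γ b′ ≟ s))
       (subst (0 <_) (inter r s a b a′ b′ (trans ab≡t (sym a′b′≡t)))
         (∃⇒0<count (λ γ → (col a γ ≟ r) ×-dec (col γ b ≟ s)) (aγ≡r , γb≡s)))

  col-diagˡ : ∀ {a b a′ b′} → col a b ≡ col a′ b′ → col a a ≡ col a′ a′
  col-diagˡ {a} {b} {a′} {b′} eq with γ , a′γ , _ ← ∈·-intro {γ = a} refl refl refl a′ b′ (sym eq)
    with refl ← diag a a′ γ (sym a′γ) = sym a′γ

  col-diagʳ : ∀ {a b a′ b′} → col a b ≡ col a′ b′ → col b b ≡ col b′ b′
  col-diagʳ {a} {b} {a′} {b′} eq with γ , _ , γb′ ← ∈·-intro {γ = b} refl refl refl a′ b′ (sym eq)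
    with refl ← diag b γ b′ (sym γb′) = sym γb′

  col-swap : ∀ {a b a′ b′} → col a b ≡ col a′ b′ → col b a ≡ col b′ a′
  col-swap {a} {b} {a′} {b′} eq with r′ , r⇔r′ ← transp (col a b) =
    trans (Equivalence.to (r⇔r′ a b) refl) (sym (Equivalence.to (r⇔r′ a′ b′) (sym eq)))

  col-diag-isFiber : ∀ a → IsFiber X (col a a)
  col-diag-isFiber a a′ b′ eq = diag a a′ b′ (sym eq)

module TypeGProperties {m : ℕ} {G : Fin m → FinGroup} (𝒳 : QCfg G) where
  open QCfg 𝒳
  open CC cc
  open TypeG typ
  open CCProperties cc
  open Family G

  φ-∙ : ∀ {a b c i g h} → col a b ≡ φ i g → col b c ≡ φ i h → col a c ≡ φ i (g ∙⟨ i ⟩ h)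
  φ-∙ {a} {c = c} {i} {g} {h} ab bc = Equivalence.to (φ-hom i g h (col a c)) (∈·-intro refl ab bc)

  φ-thin : ∀ i g → Thin cc (φ i g)
  φ-thin i g = quasi (fib i) (fib-fiber i) (φ i g) (φ-in i g)

  fibre-point : ∀ i → ∃ λ a → col a a ≡ fib i
  fibre-point i with a , b , ab ← col-onto (fib i) with refl ← fib-fiber i a b ab = a , ab

  φ-between : ∀ {a b i} → col a a ≡ fib i → col b b ≡ fib i → ∃ λ g → col a b ≡ φ i g
  φ-between {a} {b} {i} aa bb with g , φg ← φ-onto i (col a b) (λ _ _ eq → trans (col-diagˡ eq) aa , trans (col-diagʳ eq) bb) =
    g , sym φg

  φ-ε : ∀ i → φ i ε⟨ i ⟩ ≡ fib i
  φ-ε i with a , aa ← fibre-point i with e , aa≡φe ← φ-between aa aa =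
    trans (cong (φ i) (sym e≡ε)) (trans (sym aa≡φe) aa)
    where
    e≡ε : e ≡ ε⟨ i ⟩
    e≡ε = Gᵢ.identityˡ-unique i e e (sym (φ-inj i _ _ (trans (sym aa≡φe) (φ-∙ aa≡φe aa≡φe))))

  φ-successor : ∀ {a i} → col a a ≡ fib i → ∀ g → ∃ λ b → col a b ≡ φ i g
  φ-successor {a} {i} aa g with a₀ , b₀ , a₀b₀ ← col-onto (φ i g)
    with b , ab , _ ← ∈·-intro {γ = b₀} refl a₀b₀ refl a a (trans aa (sym (proj₁ (φ-in i g a₀ b₀ a₀b₀)))) = b , ab

  fibreOf : ∀ a → ∃ λ i → col a a ≡ fib i
  fibreOf a with i , fib≡ ← fib-onto (col a a) (col-diag-isFiber a) = i , sym fib≡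

module Coordinates {m : ℕ} {G : Fin m → FinGroup} (𝒳 : QCfg G) (α : BasePoints 𝒳) where
  open QCfg 𝒳
  open CC cc
  open TypeG typ
  open CCProperties cc
  open TypeGProperties 𝒳
  open Family G

  pt : Fin m → Fin n
  pt i = proj₁ (α i)

  pt-fib : ∀ i → col (pt i) (pt i) ≡ fib i
  pt-fib i = proj₂ (α i)

  ι : ∀ i → Elt (G i) → Fin n
  ι i g = proj₁ (φ-successor (pt-fib i) g)

  pt-ι : ∀ i g → col (pt i) (ι i g) ≡ φ i g
  pt-ι i g = proj₂ (φ-successor (pt-fib i) g)

  ι-fib : ∀ i g → col (ι i g) (ι i g) ≡ fib i
  ι-fib i g = proj₂ (φ-in i g _ _ (pt-ι i g))

  ι-unique : ∀ {i g b} → col (pt i) b ≡ φ i g → b ≡ ι i g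
  ι-unique {i} {g} eq = proj₁ (φ-thin i g) (pt i) _ _ eq (pt-ι i g)

  ι-ε : ∀ i → pt i ≡ ι i ε⟨ i ⟩
  ι-ε i = ι-unique (trans (pt-fib i) (sym (φ-ε i)))

  ι-onto : ∀ {b i} → col b b ≡ fib i → ∃ λ g → b ≡ ι i g
  ι-onto {b} {i} bb with g , eq ← φ-between (pt-fib i) bb = g , ι-unique eq

  ι-col : ∀ i x y → col (ι i x) (ι i y) ≡ φ i (x ⁻¹⟨ i ⟩ ∙⟨ i ⟩ y)
  ι-col i x y with g , eq ← φ-between (ι-fib i x) (ι-fib i y) = trans eq (cong (φ i) g≡)
    where
    x∙g≡y : x ∙⟨ i ⟩ g ≡ y
    x∙g≡y = φ-inj i _ _ (trans (sym (φ-∙ (pt-ι i x) eq)) (pt-ι i y))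
    g≡ : g ≡ x ⁻¹⟨ i ⟩ ∙⟨ i ⟩ y
    g≡ = trans (sym (Gᵢ.\\-leftDividesʳ i x g)) (cong (λ u → x ⁻¹⟨ i ⟩ ∙⟨ i ⟩ u) x∙g≡y)

  ι-col-∙ : ∀ i x u → col (ι i x) (ι i (x ∙⟨ i ⟩ u)) ≡ φ i u
  ι-col-∙ i x u = trans (ι-col i x _) (cong (φ i) (Gᵢ.\\-leftDividesʳ i x u))

  ι-injective : ∀ i {g h} → ι i g ≡ ι i h → g ≡ h
  ι-injective i {g} {h} eq = φ-inj i g h (trans (sym (pt-ι i g)) (trans (cong (col (pt i)) eq) (pt-ι i h)))

  ιₚ : Point → Fin n
  ιₚ (i , g) = ι i g

  ιₚ-injective : ∀ {p q} → ιₚ p ≡ ιₚ q → p ≡ q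
  ιₚ-injective {i , g} {j , h} eq
    with refl ← fib-inj i j (trans (sym (ι-fib i g)) (trans (cong (λ a → col a a) eq) (ι-fib j h))) =
    cong (i ,_) (ι-injective i eq)

  coord : Fin n → Point
  coord a = proj₁ (fibreOf a) , proj₁ (ι-onto (proj₂ (fibreOf a)))

  ιₚ-coord : ∀ a → ιₚ (coord a) ≡ a
  ιₚ-coord a = sym (proj₂ (ι-onto (proj₂ (fibreOf a))))

  coord-ιₚ : ∀ p → coord (ιₚ p) ≡ p
  coord-ιₚ p = ιₚ-injective (ιₚ-coord (ιₚ p))

  Col : ∀ i j → Elt (G i) → Elt (G j) → Fin k
  Col i j x y = col (ι i x) (ι j y)

  Linked : LinkedRel G
  Linked i j x y = Col i j x y ≡ Col i j ε⟨ i ⟩ ε⟨ j ⟩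

  -- Transport the step ι i x → ι i (x u) along the colour; thinness of φ i u pins down its end.
  Col-shiftˡ : ∀ {i j x y x′ y′} u → Col i j x y ≡ Col i j x′ y′ →
               Col i j (x ∙⟨ i ⟩ u) y ≡ Col i j (x′ ∙⟨ i ⟩ u) y′
  Col-shiftˡ {i} {j} {x} {y} {x′} {y′} u eq
    with γ , x′γ , γy′ ← ∈·-intro {γ = ι i (x ∙⟨ i ⟩ u)} refl (ι-col-∙ i x u) refl (ι i x′) (ι j y′) (sym eq)
    with refl ← proj₁ (φ-thin i u) (ι i x′) γ _ x′γ (ι-col-∙ i x′ u) = sym γy′

  Col-shiftʳ : ∀ {i j x y x′ y′} v → Col i j x y ≡ Col i j x′ y′ →
               Col i j x (y ∙⟨ j ⟩ v) ≡ Col i j x′ (y′ ∙⟨ j ⟩ v)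
  Col-shiftʳ v eq = col-swap (Col-shiftˡ v (col-swap eq))

  Col-shift : ∀ {i j x y x′ y′} u v → Col i j x y ≡ Col i j x′ y′ →
              Col i j (x ∙⟨ i ⟩ u) (y ∙⟨ j ⟩ v) ≡ Col i j (x′ ∙⟨ i ⟩ u) (y′ ∙⟨ j ⟩ v)
  Col-shift u v eq = Col-shiftʳ v (Col-shiftˡ u eq)

  Col≡⇒Linked : ∀ {i j x y x′ y′} → Col i j x y ≡ Col i j x′ y′ → Linked i j (x //⟨ i ⟩ x′) (y //⟨ j ⟩ y′)
  Col≡⇒Linked {i} {j} {x} {y} {x′} {y′} eq =
    trans (Col-shift (x′ ⁻¹⟨ i ⟩) (y′ ⁻¹⟨ j ⟩) eq) (cong₂ (Col i j) (Gᵢ.inverseʳ i x′) (Gᵢ.inverseʳ j y′))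

  Linked⇒Col≡ : ∀ {i j x y x′ y′} → Linked i j (x //⟨ i ⟩ x′) (y //⟨ j ⟩ y′) → Col i j x y ≡ Col i j x′ y′
  Linked⇒Col≡ {i} {j} {x} {y} {x′} {y′} r = begin
    Col i j x y
      ≡⟨ cong₂ (Col i j) (Gᵢ.//-rightDividesˡ i x′ x) (Gᵢ.//-rightDividesˡ j y′ y) ⟨
    Col i j ((x //⟨ i ⟩ x′) ∙⟨ i ⟩ x′) ((y //⟨ j ⟩ y′) ∙⟨ j ⟩ y′)
      ≡⟨ Col-shift x′ y′ r ⟩
    Col i j (ε⟨ i ⟩ ∙⟨ i ⟩ x′) (ε⟨ j ⟩ ∙⟨ j ⟩ y′)
      ≡⟨ cong₂ (Col i j) (Gᵢ.identityˡ i x′) (Gᵢ.identityˡ j y′) ⟩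
    Col i j x′ y′
      ∎
    where open ≡-Reasoning

  Linked-∙ : ∀ {i j x y x′ y′} → Linked i j x y → Linked i j x′ y′ →
             Linked i j (x ∙⟨ i ⟩ x′) (y ∙⟨ j ⟩ y′)
  Linked-∙ {i} {j} {x′ = x′} {y′} r r′ =
    trans (Col-shift x′ y′ r) (trans (cong₂ (Col i j) (Gᵢ.identityˡ i x′) (Gᵢ.identityˡ j y′)) r′)

  Linked-⁻¹ : ∀ {i j x y} → Linked i j x y → Linked i j (x ⁻¹⟨ i ⟩) (y ⁻¹⟨ j ⟩)
  Linked-⁻¹ {i} {j} {x} {y} r = begin
    Col i j (x ⁻¹⟨ i ⟩) (y ⁻¹⟨ j ⟩)
      ≡⟨ cong₂ (Col i j) (Gᵢ.identityˡ i _) (Gᵢ.identityˡ j _) ⟨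
    Col i j (ε⟨ i ⟩ ∙⟨ i ⟩ x ⁻¹⟨ i ⟩) (ε⟨ j ⟩ ∙⟨ j ⟩ y ⁻¹⟨ j ⟩)
      ≡⟨ Col-shift (x ⁻¹⟨ i ⟩) (y ⁻¹⟨ j ⟩) r ⟨
    Col i j (x //⟨ i ⟩ x) (y //⟨ j ⟩ y)
      ≡⟨ cong₂ (Col i j) (Gᵢ.inverseʳ i x) (Gᵢ.inverseʳ j y) ⟩
    Col i j ε⟨ i ⟩ ε⟨ j ⟩
      ∎
    where open ≡-Reasoning

  Col-εε : ∀ i j → Col i j ε⟨ i ⟩ ε⟨ j ⟩ ≡ col (pt i) (pt j)
  Col-εε i j = sym (cong₂ col (ι-ε i) (ι-ε j))

  Linked-total : ∀ i j x → ∃ (Linked i j x)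
  Linked-total i j x
    with γ , xγ , _ ← ∈·-intro {γ = pt j} refl refl refl (ι i x) (ι i x) (trans (ι-fib i x) (sym (pt-fib i)))
    with y , refl ← ι-onto (trans (col-diagʳ xγ) (pt-fib j)) = y , trans xγ (sym (Col-εε i j))

  Linked-diag : ∀ {i x y} → Linked i i x y → x ≡ y
  Linked-diag {i} {x} {y} r = begin
    x                              ≡⟨ Gᵢ.identityʳ i x ⟨
    x ∙⟨ i ⟩ ε⟨ i ⟩                 ≡⟨ cong (λ u → x ∙⟨ i ⟩ u) x⁻¹y≡ε ⟨
    x ∙⟨ i ⟩ (x ⁻¹⟨ i ⟩ ∙⟨ i ⟩ y)    ≡⟨ Gᵢ.\\-leftDividesˡ i x y ⟩
    y                              ∎
    where
    open ≡-Reasoning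
    x⁻¹y≡ε : x ⁻¹⟨ i ⟩ ∙⟨ i ⟩ y ≡ ε⟨ i ⟩
    x⁻¹y≡ε = trans (φ-inj i _ _ (trans (sym (ι-col i x y)) (trans r (ι-col i _ _)))) (Gᵢ.inverseˡ i _)

  Linked-split : ∀ {i j} k {x y} → Linked i j x y → ∃ λ z → Linked i k x z × Linked k j z y
  Linked-split {i} {j} k {x} {y} r
    with γ , xγ , γy ← ∈·-intro {γ = ι k ε⟨ k ⟩} refl refl refl (ι i x) (ι j y) r
    with z , refl ← ι-onto (trans (col-diagʳ xγ) (ι-fib k ε⟨ k ⟩)) = z , xγ , γy

  linkedSubgroupsOf : LinkedSubgroups G
  linkedSubgroupsOf = record
    { R       = Linked
    ; R?      = λ i j x y → Col i j x y ≟ Col i j ε⟨ i ⟩ ε⟨ j ⟩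
    ; R-∙     = Linked-∙
    ; R-⁻¹    = Linked-⁻¹
    ; R-total = Linked-total
    ; R-diag  = Linked-diag
    ; R-sym   = col-swap
    ; R-split = Linked-split
    }

  -- The sets G_ij, G_ij g and s_ij* (G_ij g) s_ij local to Realizes.
  s : Fin m → Fin m → Fin k
  s i j = col (pt i) (pt j)

  Gsub : ∀ i j → Elt (G i) → Set
  Gsub i j g = SetProd cc (_≡ s i j) (Star cc (s i j)) (φ i g)

  Coset : ∀ i j → Elt (G i) → Fin k → Set
  Coset i j g t = ∃ λ x → Gsub i j x × t ≡ φ i (x ∙⟨ i ⟩ g)

  Image : ∀ i j → Elt (G i) → Fin k → Set
  Image i j g = SetProd cc (Star cc (s i j)) (SetProd cc (Coset i j g) (_≡ s i j))

  Linked⇒s : ∀ {i j x y} → Linked i j x y → col (ι i x) (ι j y) ≡ s i j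
  Linked⇒s {i} {j} r = trans r (Col-εε i j)

  s⇒Linked : ∀ {i j x y} → col (ι i x) (ι j y) ≡ s i j → Linked i j x y
  s⇒Linked {i} {j} eq = trans eq (sym (Col-εε i j))

  star : ∀ i j → ∃ (Star cc (s i j))
  star i j with r′ , r⇔r′ ← transp (s i j) = r′ , λ a b → ⇔.sym (r⇔r′ b a)

  Gsub⇒Linked : ∀ {i j g} → Gsub i j g → Linked i j g ε⟨ j ⟩
  Gsub⇒Linked {i} {j} {g} (_ , r′ , refl , st , g∈) with γ , ptγ , γg ← g∈ (pt i) (ι i g) (pt-ι i g)
    with v , refl ← ι-onto (trans (col-diagʳ ptγ) (pt-fib j)) =
    subst₂ (Linked i j) (Gᵢ.x//ε≈x i g) (Gᵢ.inverseʳ j v) (Col≡⇒Linked gv≡εv)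
    where
    gv≡εv : Col i j g v ≡ Col i j ε⟨ i ⟩ v
    gv≡εv = trans (Equivalence.to (st _ _) γg) (trans (sym ptγ) (cong (λ a → col a (ι j v)) (ι-ε i)))

  Linked⇒Gsub : ∀ {i j g} → Linked i j g ε⟨ j ⟩ → Gsub i j g
  Linked⇒Gsub {i} {j} {g} r = s i j , proj₁ (star i j) , refl , proj₂ (star i j) ,
    ∈·-intro {γ = pt j} (pt-ι i g) refl
      (Equivalence.from (proj₂ (star i j) _ _) (trans (cong (col (ι i g)) (ι-ε j)) (Linked⇒s r)))

  Image⇒Linked : ∀ {i j g t} → Image i j g t → ∃ λ y → t ≡ φ j y × Linked i j g y
  Image⇒Linked {i} {j} {g} {t} (_ , _ , st , (_ , _ , (x , x∈ , refl) , refl , r₂∈) , t∈)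
    with a , b , ab ← col-onto t
    with γ , aγ , γb ← t∈ a b ab
    with δ , γδ , δb ← r₂∈ γ b γb
    with γa ← Equivalence.to (st _ _) aγ
    with u , refl ← ι-onto (trans (col-diagˡ γa) (pt-fib i))
    with v , refl ← ι-onto (trans (col-diagʳ γa) (pt-fib j))
    with w , refl ← ι-onto (proj₂ (φ-in i _ _ _ γδ))
    with y , refl ← ι-onto (trans (col-diagʳ δb) (pt-fib j)) =
    v ⁻¹⟨ j ⟩ ∙⟨ j ⟩ y , trans (sym ab) (ι-col j v y) ,
    subst₂ (Linked i j) (Gᵢ.\\-leftDividesʳ i x g) (Gᵢ.ε\\x≈x j _) (R-∙ (R-⁻¹ (Gsub⇒Linked x∈)) uw-vy)
    where
    open LinkedSubgroups linkedSubgroupsOf using (R-∙; R-⁻¹)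
    u⁻¹w≡xg : u ⁻¹⟨ i ⟩ ∙⟨ i ⟩ w ≡ x ∙⟨ i ⟩ g
    u⁻¹w≡xg = φ-inj i _ _ (trans (sym (ι-col i u w)) γδ)
    uw-vy : Linked i j (x ∙⟨ i ⟩ g) (v ⁻¹⟨ j ⟩ ∙⟨ j ⟩ y)
    uw-vy = subst (λ z → Linked i j z (v ⁻¹⟨ j ⟩ ∙⟨ j ⟩ y)) u⁻¹w≡xg
                  (R-∙ (R-⁻¹ (s⇒Linked γa)) (s⇒Linked δb))

  Linked⇒Image : ∀ {i j g t} → (∃ λ y → t ≡ φ j y × Linked i j g y) → Image i j g t
  Linked⇒Image {i} {j} {g} (y , refl , r) =
    proj₁ (star i j) , col (pt i) (ι j y) , proj₂ (star i j) ,
    (φ i g , s i j , (ε⟨ i ⟩ , Linked⇒Gsub (R-ε i j) , cong (φ i) (sym (Gᵢ.identityˡ i g))) , refl ,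
      ∈·-intro {γ = ι i g} refl (pt-ι i g) (Linked⇒s r)) ,
    ∈·-intro {γ = pt i} (pt-ι j y) (Equivalence.from (proj₂ (star i j) _ _) refl) refl
    where open LinkedSubgroups linkedSubgroupsOf using (R-ε)

  Image⇔Linked : ∀ i j g t → Image i j g t ⇔ (∃ λ y → t ≡ φ j y × Linked i j g y)
  Image⇔Linked i j g t = mk⇔ Image⇒Linked Linked⇒Image

  ∃φ≡⇔ : ∀ {j y} (P : Elt (G j) → Set) → (∃ λ y′ → φ j y ≡ φ j y′ × P y′) ⇔ P y
  ∃φ≡⇔ {j} P = mk⇔ (λ (_ , eq , p) → subst P (sym (φ-inj j _ _ eq)) p) (λ p → _ , refl , p)

  module _ (L : LinkedQuotients G) where
    open LinkedQuotients L
    open FromLinkedQuotients L using (∈N⇔Graph)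
    private
      module N (i j : Fin m) = NormalSubgroup (N-normal i j)

    Graph⇔Coset : ∀ {i j g t} → (∀ x → x ∈ N j i ⇔ Gsub j i x) →
                  (∃ λ y → t ≡ φ j y × Graph L i j g y) ⇔ Coset j i (F i j g) t
    Graph⇔Coset {i} {j} {g} N⇔Gsub = mk⇔
      (λ (y , t≡ , Fg≈y) → y //⟨ j ⟩ F i j g , Equivalence.to (N⇔Gsub _) (N.≈-sym j i Fg≈y) ,
                            trans t≡ (cong (φ j) (sym (Gᵢ.//-rightDividesˡ j _ y))))
      (λ (x , x∈ , t≡) → x ∙⟨ j ⟩ F i j g , t≡ , N.∈⇒≈∙ˡ j i (Equivalence.from (N⇔Gsub x) x∈))

    Linked≐Graph⇒Realizes : Linked ≐ Graph L → Realizes 𝒳 α L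
    Linked≐Graph⇒Realizes Linked≐Graph = N⇔Gsub , Image⇔Coset
      where
      open ≈-Reasoning (⇔-setoid 0ℓ)
      N⇔Gsub : ∀ i j g → g ∈ N i j ⇔ Gsub i j g
      N⇔Gsub i j g = begin
        g ∈ N i j                  ≈⟨ ∈N⇔Graph i j g ⟩
        Graph L i j g ε⟨ j ⟩        ≈⟨ Linked≐Graph i j g ε⟨ j ⟩ ⟨
        Linked i j g ε⟨ j ⟩         ≈⟨ mk⇔ Linked⇒Gsub Gsub⇒Linked ⟩
        Gsub i j g                 ∎
      Image⇔Coset : ∀ i j g t → Image i j g t ⇔ Coset j i (F i j g) t
      Image⇔Coset i j g t = begin
        Image i j g t                                ≈⟨ Image⇔Linked i j g t ⟩
        (∃ λ y → t ≡ φ j y × Linked i j g y)         ≈⟨ mk⇔ (map₂ (map₂ (Equivalence.to (Linked≐Graph i j g _))))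
                                                            (map₂ (map₂ (Equivalence.from (Linked≐Graph i j g _)))) ⟩
        (∃ λ y → t ≡ φ j y × Graph L i j g y)        ≈⟨ Graph⇔Coset (N⇔Gsub j i) ⟩
        Coset j i (F i j g) t                        ∎

    Realizes⇒Linked≐Graph : Realizes 𝒳 α L → Linked ≐ Graph L
    Realizes⇒Linked≐Graph (N⇔Gsub , Image⇔Coset) i j x y = begin
      Linked i j x y                                 ≈⟨ ∃φ≡⇔ (Linked i j x) ⟨
      (∃ λ y′ → φ j y ≡ φ j y′ × Linked i j x y′)    ≈⟨ Image⇔Linked i j x (φ j y) ⟨
      Image i j x (φ j y)                            ≈⟨ Image⇔Coset i j x (φ j y) ⟩
      Coset j i (F i j x) (φ j y)                    ≈⟨ Graph⇔Coset (N⇔Gsub j i) ⟨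
      (∃ λ y′ → φ j y ≡ φ j y′ × Graph L i j x y′)   ≈⟨ ∃φ≡⇔ (Graph L i j x) ⟩
      Graph L i j x y                                ∎
      where open ≈-Reasoning (⇔-setoid 0ℓ)

  col≡⇔SameColour : ∀ p q p′ q′ →
                    col (ιₚ p) (ιₚ q) ≡ col (ιₚ p′) (ιₚ q′) ⇔ SameColour Linked p q p′ q′
  col≡⇔SameColour (i , x) (j , y) (i′ , x′) (j′ , y′) =
    mk⇔ to (λ { (same r) → Linked⇒Col≡ {i} {j} {x} {y} {x′} {y′} r })
    where
    to : col (ι i x) (ι j y) ≡ col (ι i′ x′) (ι j′ y′) → SameColour Linked (i , x) (j , y) (i′ , x′) (j′ , y′)
    to eq with refl ← fib-inj i i′ (trans (sym (ι-fib i x)) (trans (col-diagˡ eq) (ι-fib i′ x′)))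
              | refl ← fib-inj j j′ (trans (sym (ι-fib j y)) (trans (col-diagʳ eq) (ι-fib j′ y′))) =
      same (Col≡⇒Linked {i} {j} {x} {y} {x′} {y′} eq)

  col≡φ⇔Translate : ∀ i g p q → col (ιₚ p) (ιₚ q) ≡ φ i g ⇔ Translate i g p q
  col≡φ⇔Translate i g (i′ , x) (j′ , y) = mk⇔ to (λ { (translate eq) → trans (ι-col i x y) (cong (φ i) eq) })
    where
    to : col (ι i′ x) (ι j′ y) ≡ φ i g → Translate i g (i′ , x) (j′ , y)
    to eq with refl ← fib-inj i′ i (trans (sym (ι-fib i′ x)) (proj₁ (φ-in i g (ι i′ x) (ι j′ y) eq)))
              | refl ← fib-inj j′ i (trans (sym (ι-fib j′ y)) (proj₂ (φ-in i g (ι i′ x) (ι j′ y) eq))) =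
      translate (φ-inj i (x ⁻¹⟨ i ⟩ ∙⟨ i ⟩ y) g (trans (sym (ι-col i x y)) eq))

module _ {m : ℕ} {G : Fin m → FinGroup} where
  open Family G

  Linked≐⇒Iso : (𝒳 𝒴 : QCfg G) (α : BasePoints 𝒳) (β : BasePoints 𝒴) →
                   Coordinates.Linked 𝒳 α ≐ Coordinates.Linked 𝒴 β → Iso 𝒳 𝒴
  Linked≐⇒Iso 𝒳 𝒴 α β LX≐LY = record { σ = σ ; pres = pres ; compat = compat }
    where
    module X = Coordinates 𝒳 α
    module Y = Coordinates 𝒴 β
    module CX = CC (QCfg.cc 𝒳)
    module CY = CC (QCfg.cc 𝒴)
    σ : Fin CX.n ↔ Fin CY.n
    σ = mk↔ₛ′ (Y.ιₚ ∘ X.coord) (X.ιₚ ∘ Y.coord)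
              (λ b → trans (cong Y.ιₚ (X.coord-ιₚ (Y.coord b))) (Y.ιₚ-coord b))
              (λ a → trans (cong X.ιₚ (Y.coord-ιₚ (X.coord a))) (X.ιₚ-coord a))
    col-coord : ∀ a b → CX.col (X.ιₚ (X.coord a)) (X.ιₚ (X.coord b)) ≡ CX.col a b
    col-coord a b = cong₂ CX.col (X.ιₚ-coord a) (X.ιₚ-coord b)
    pres : ∀ a b a′ b′ → (CX.col a b ≡ CX.col a′ b′) ⇔
                         (CY.col (Y.ιₚ (X.coord a)) (Y.ιₚ (X.coord b)) ≡ CY.col (Y.ιₚ (X.coord a′)) (Y.ιₚ (X.coord b′)))
    pres a b a′ b′ = begin
      CX.col a b ≡ CX.col a′ b′
        ≈⟨ mk⇔ (λ eq → trans (col-coord a b) (trans eq (sym (col-coord a′ b′))))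
               (λ eq → trans (sym (col-coord a b)) (trans eq (col-coord a′ b′))) ⟩
      CX.col (X.ιₚ (X.coord a)) (X.ιₚ (X.coord b)) ≡ CX.col (X.ιₚ (X.coord a′)) (X.ιₚ (X.coord b′))
        ≈⟨ X.col≡⇔SameColour (X.coord a) (X.coord b) (X.coord a′) (X.coord b′) ⟩
      SameColour X.Linked (X.coord a) (X.coord b) (X.coord a′) (X.coord b′)
        ≈⟨ mk⇔ (SameColour-map (Equivalence.to (LX≐LY _ _ _ _))) (SameColour-map (Equivalence.from (LX≐LY _ _ _ _))) ⟩
      SameColour Y.Linked (X.coord a) (X.coord b) (X.coord a′) (X.coord b′)
        ≈⟨ Y.col≡⇔SameColour (X.coord a) (X.coord b) (X.coord a′) (X.coord b′) ⟨
      CY.col (Y.ιₚ (X.coord a)) (Y.ιₚ (X.coord b)) ≡ CY.col (Y.ιₚ (X.coord a′)) (Y.ιₚ (X.coord b′))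
        ∎
      where open ≈-Reasoning (⇔-setoid 0ℓ)
    compat : ∀ i g a b → CX.col a b ≡ TypeG.φ (QCfg.typ 𝒳) i g →
             CY.col (Y.ιₚ (X.coord a)) (Y.ιₚ (X.coord b)) ≡ TypeG.φ (QCfg.typ 𝒴) i g
    compat i g a b eq = Equivalence.from (Y.col≡φ⇔Translate i g (X.coord a) (X.coord b))
                          (Equivalence.to (X.col≡φ⇔Translate i g (X.coord a) (X.coord b)) (trans (col-coord a b) eq))

  Iso⇒Linked≐ : (𝒳 𝒴 : QCfg G) → Iso 𝒳 𝒴 → (α : BasePoints 𝒳) →
                     Σ (BasePoints 𝒴) λ β → Coordinates.Linked 𝒴 β ≐ Coordinates.Linked 𝒳 α
  Iso⇒Linked≐ 𝒳 𝒴 I α = β , λ i j x y →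
    ⇔.trans (Col-σ≡ i j x y) (⇔.sym (pres (X.ι i x) (X.ι j y) (X.ι i ε⟨ i ⟩) (X.ι j ε⟨ j ⟩)))
    where
    open Iso I
    module X = Coordinates 𝒳 α
    module TX = TypeGProperties 𝒳
    module TY = TypeGProperties 𝒴
    module CY = CC (QCfg.cc 𝒴)
    β : BasePoints 𝒴
    β i = σf (X.pt i) , trans (compat i ε⟨ i ⟩ (X.pt i) (X.pt i) (trans (X.pt-fib i) (sym (TX.φ-ε i)))) (TY.φ-ε i)
    module Y = Coordinates 𝒴 β
    ι-σ : ∀ i g → Y.ι i g ≡ σf (X.ι i g)
    ι-σ i g = sym (Y.ι-unique (compat i g (X.pt i) (X.ι i g) (X.pt-ι i g)))
    Col-σ : ∀ i j x y → Y.Col i j x y ≡ CY.col (σf (X.ι i x)) (σf (X.ι j y))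
    Col-σ i j x y = cong₂ CY.col (ι-σ i x) (ι-σ j y)
    Col-σ≡ : ∀ i j x y → Y.Linked i j x y ⇔
             (CY.col (σf (X.ι i x)) (σf (X.ι j y)) ≡ CY.col (σf (X.ι i ε⟨ i ⟩)) (σf (X.ι j ε⟨ j ⟩)))
    Col-σ≡ i j x y = mk⇔ (λ r → trans (sym (Col-σ i j x y)) (trans r (Col-σ i j ε⟨ i ⟩ ε⟨ j ⟩)))
                         (λ eq → trans (Col-σ i j x y) (trans eq (sym (Col-σ i j ε⟨ i ⟩ ε⟨ j ⟩))))

-- The configuration of a linked family of subgroups

module _ {m : ℕ} {G : Fin m → FinGroup} where
  open Family G

  translate-by : ∀ i x g → Translate i g (i , x) (i , x ∙⟨ i ⟩ g)
  translate-by i x g = translate (Gᵢ.\\-leftDividesʳ i x g)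

  Translate-∙ : ∀ {i g h p q r} → Translate i g p q → Translate i h q r → Translate i (g ∙⟨ i ⟩ h) p r
  Translate-∙ {i} (translate {x} {y} refl) (translate refl) = translate (sym (Gᵢ.\\-chain i x y _))

  Translate-functional : ∀ {i g p q q′} → Translate i g p q → Translate i g p q′ → q ≡ q′
  Translate-functional {i} (translate {x} {y} refl) (translate {y = y′} eq) =
    cong (i ,_) (Gᵢ.∙-cancelˡ i (x ⁻¹⟨ i ⟩) y y′ (sym eq))

  Translate-injective : ∀ {i g p p′ q} → Translate i g p q → Translate i g p′ q → p ≡ p′
  Translate-injective {i} (translate {x} {y} refl) (translate {x′} eq) =
    cong (i ,_) (Gᵢ.⁻¹-injective i (Gᵢ.∙-cancelʳ i y _ _ (sym eq)))

  Translate-split : ∀ {i g h p r} → Translate i (g ∙⟨ i ⟩ h) p r → ∃ λ q → Translate i g p q × Translate i h q r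
  Translate-split {i} {g} {h} (translate {x} {y} x⁻¹y≡gh) = (i , x ∙⟨ i ⟩ g) , translate-by i x g , translate (begin
    (x ∙⟨ i ⟩ g) ⁻¹⟨ i ⟩ ∙⟨ i ⟩ y               ≡⟨ cong (λ u → u ∙⟨ i ⟩ y) (Gᵢ.⁻¹-anti-homo-∙ i x g) ⟩
    (g ⁻¹⟨ i ⟩ ∙⟨ i ⟩ x ⁻¹⟨ i ⟩) ∙⟨ i ⟩ y        ≡⟨ Gᵢ.assoc i _ _ _ ⟩
    g ⁻¹⟨ i ⟩ ∙⟨ i ⟩ (x ⁻¹⟨ i ⟩ ∙⟨ i ⟩ y)        ≡⟨ cong (λ u → g ⁻¹⟨ i ⟩ ∙⟨ i ⟩ u) x⁻¹y≡gh ⟩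
    g ⁻¹⟨ i ⟩ ∙⟨ i ⟩ (g ∙⟨ i ⟩ h)               ≡⟨ Gᵢ.\\-leftDividesʳ i g h ⟩
    h                                         ∎)
    where open ≡-Reasoning

  Translate-fibre : ∀ {i j g x q} → Translate j g (i , x) q → i ≡ j
  Translate-fibre (translate _) = refl

  Translate-refl : ∀ i x → Translate i ε⟨ i ⟩ (i , x) (i , x)
  Translate-refl i x = translate (Gᵢ.inverseˡ i x)

  Translate-ε : ∀ {i p q} → Translate i ε⟨ i ⟩ p q → p ≡ q
  Translate-ε t@(translate {x} _) = Translate-functional (Translate-refl _ x) t

  Translate-unique : ∀ {i g h p q} → Translate i g p q → Translate i h p q → g ≡ h
  Translate-unique (translate refl) (translate eq) = eq

module ConfigurationOf {m : ℕ} {G : Fin m → FinGroup} (Γ : LinkedSubgroups G) where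
  open Family G
  open LinkedSubgroups Γ

  SamePairColour : Rel (Point × Point) 0ℓ
  SamePairColour (p , q) (p′ , q′) = SameColour R p q p′ q′

  SamePairColour-isDecEquivalence : IsDecEquivalence SamePairColour
  SamePairColour-isDecEquivalence = record
    { isEquivalence = record
      { refl  = λ { {(i , x) , (j , y)} → same (subst₂ (R i j) (sym (Gᵢ.inverseʳ i x)) (sym (Gᵢ.inverseʳ j y)) (R-ε i j)) }
      ; sym   = λ { (same {i} {j} {x} {y} {x′} {y′} r) →
                      same (subst₂ (R i j) (Gᵢ.⁻¹-anti-homo-// i x x′) (Gᵢ.⁻¹-anti-homo-// j y y′) (R-⁻¹ r)) }
      ; trans = λ { (same {i} {j} {x} {y} {x′} {y′} r) (same {x′ = x″} {y′ = y″} r′) →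
                      same (subst₂ (R i j) (Gᵢ.//-chain i x x′ x″) (Gᵢ.//-chain j y y′ y″) (R-∙ r r′)) }
      }
    ; _≟_ = decide
    }
    where
    decide : ∀ a b → Dec (SamePairColour a b)
    decide ((i , x) , (j , y)) ((i′ , x′) , (j′ , y′)) with i ≟ i′ | j ≟ j′
    ... | no i≢i′ | _       = no λ { (same _) → i≢i′ refl }
    ... | yes _   | no j≢j′ = no λ { (same _) → j≢j′ refl }
    ... | yes refl | yes refl with R? i j (x //⟨ i ⟩ x′) (y //⟨ j ⟩ y′)
    ...   | yes r  = yes (same r)
    ...   | no ¬r  = no λ { (same r) → ¬r r }

  n : ℕ
  n = sum (FinGroup.order ∘ G)

  Point↔Fin : Point ↔ Fin n
  Point↔Fin = Σ-Fin↔Fin-sum (FinGroup.order ∘ G)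

  open Inverse Point↔Fin using (to; from; strictlyInverseˡ; strictlyInverseʳ)

  colourQuotient : FinQuotient SamePairColour
  colourQuotient = finQuotient-↔ (↔-trans (Point↔Fin ×-↔ Point↔Fin) (↔-sym *↔×)) SamePairColour-isDecEquivalence

  open FinQuotient colourQuotient renaming (size to k)

  colourₚ : Point → Point → Fin k
  colourₚ p q = classify (p , q)

  col : Fin n → Fin n → Fin k
  col a b = colourₚ (from a) (from b)

  col-to : ∀ p q → col (to p) (to q) ≡ colourₚ p q
  col-to p q = cong₂ colourₚ (strictlyInverseʳ p) (strictlyInverseʳ q)

  from-injective : ∀ {a b} → from a ≡ from b → a ≡ b
  from-injective {a} {b} eq = trans (sym (strictlyInverseˡ a)) (trans (cong to eq) (strictlyInverseˡ b))

  colourₚ-onto : ∀ c → ∃ λ ((p , q) : Point × Point) → colourₚ p q ≡ c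
  colourₚ-onto = classify-onto

  φₚ : ∀ i → Elt (G i) → Fin k
  φₚ i g = colourₚ (i , ε⟨ i ⟩) (i , g)

  colourₚ≡φₚ⇔Translate : ∀ i g p q → colourₚ p q ≡ φₚ i g ⇔ Translate i g p q
  colourₚ≡φₚ⇔Translate i g p q =
    mk⇔ (λ eq → Translate-of-same (classify-reflect eq)) (λ t → classify-resp (same-of-Translate t))
    where
    Translate-of-same : ∀ {p q} → SameColour R p q (i , ε⟨ i ⟩) (i , g) → Translate i g p q
    Translate-of-same (same {x = x} {y} r) = translate (begin
      x ⁻¹⟨ i ⟩ ∙⟨ i ⟩ y               ≡⟨ cong (λ u → u ⁻¹⟨ i ⟩ ∙⟨ i ⟩ y) (trans (sym (Gᵢ.x//ε≈x i x)) (R-diag r)) ⟩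
      (y //⟨ i ⟩ g) ⁻¹⟨ i ⟩ ∙⟨ i ⟩ y    ≡⟨ cong (λ u → u ∙⟨ i ⟩ y) (Gᵢ.⁻¹-anti-homo-// i y g) ⟩
      (g //⟨ i ⟩ y) ∙⟨ i ⟩ y           ≡⟨ Gᵢ.//-rightDividesˡ i y g ⟩
      g                               ∎)
      where open ≡-Reasoning
    same-of-Translate : ∀ {p q} → Translate i g p q → SameColour R p q (i , ε⟨ i ⟩) (i , g)
    same-of-Translate (translate {x} {y} refl) = same (subst (R i i _) x//ε≡y//x⁻¹y (R-refl i _))
      where
      x//ε≡y//x⁻¹y : x //⟨ i ⟩ ε⟨ i ⟩ ≡ y //⟨ i ⟩ (x ⁻¹⟨ i ⟩ ∙⟨ i ⟩ y)
      x//ε≡y//x⁻¹y = trans (Gᵢ.x//ε≈x i x) (trans (sym (Gᵢ.\\-leftDividesˡ i y x))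
                       (cong (λ u → y ∙⟨ i ⟩ u) (sym (Gᵢ.⁻¹-anti-homo-\\ i x y))))

  col≡φ⇔Translate : ∀ i g a b → col a b ≡ φₚ i g ⇔ Translate i g (from a) (from b)
  col≡φ⇔Translate i g a b = colourₚ≡φₚ⇔Translate i g (from a) (from b)

  SameColour-swap : ∀ {p q p′ q′} → SameColour R p q p′ q′ → SameColour R q p q′ p′
  SameColour-swap (same r) = same (R-sym r)

  SameColour-diag : ∀ {p q q′} → SameColour R p p q q′ → q ≡ q′
  SameColour-diag (same {i} {x = x} {x′ = x′} {y′} r) =
    cong (i ,_) (Gᵢ.⁻¹-injective i (Gᵢ.∙-cancelˡ i x _ _ (R-diag r)))

  -- Translate each fibre l by z l ⁻¹, where z l splits (x x′⁻¹, y y′⁻¹) through G l.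
  colour-permutation : ∀ {pa pb pa′ pb′} → SameColour R pa pb pa′ pb′ →
                       Σ (Point ↔ Point) λ π →
                         ∀ p → SameColour R pa p pa′ (Inverse.to π p) × SameColour R p pb (Inverse.to π p) pb′
  colour-permutation (same {i} {j} {x} {y} {x′} {y′} r) = π , λ (l , u) →
    same (subst (R i l _) (sym (u//z⁻¹u≡z l u)) (proj₁ (proj₂ (R-split l r)))) ,
    same (subst (λ v → R l j v _) (sym (u//z⁻¹u≡z l u)) (proj₂ (proj₂ (R-split l r))))
    where
    z : ∀ l → Elt (G l)
    z l = proj₁ (R-split l r)
    π : Point ↔ Point
    π = mk↔ₛ′ (λ (l , u) → l , z l ⁻¹⟨ l ⟩ ∙⟨ l ⟩ u) (λ (l , u) → l , z l ∙⟨ l ⟩ u)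
              (λ (l , u) → cong (l ,_) (Gᵢ.\\-leftDividesʳ l (z l) u))
              (λ (l , u) → cong (l ,_) (Gᵢ.\\-leftDividesˡ l (z l) u))
    u//z⁻¹u≡z : ∀ l u → u //⟨ l ⟩ (z l ⁻¹⟨ l ⟩ ∙⟨ l ⟩ u) ≡ z l
    u//z⁻¹u≡z l u = trans (cong (λ v → u ∙⟨ l ⟩ v) (Gᵢ.⁻¹-anti-homo-\\ l (z l) u)) (Gᵢ.\\-leftDividesˡ l u (z l))

  col-inter : ∀ r s a b a′ b′ → col a b ≡ col a′ b′ →
              count (λ γ → (col a γ ≟ r) ×-dec (col γ b ≟ s)) ≡
              count (λ γ → (col a′ γ ≟ r) ×-dec (col γ b′ ≟ s))
  col-inter r s a b a′ b′ eq with π , π-same ← colour-permutation (classify-reflect eq) =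
    count-permute _ _ (↔-trans (↔-sym Point↔Fin) (↔-trans π Point↔Fin)) λ γ →
      mk⇔ (λ (aγ , γb) → trans (sym (aγ≡ γ)) aγ , trans (sym (γb≡ γ)) γb)
          (λ (aγ , γb) → trans (aγ≡ γ) aγ , trans (γb≡ γ) γb)
    where
    πF : Fin n → Fin n
    πF γ = to (Inverse.to π (from γ))
    aγ≡ : ∀ γ → col a γ ≡ col a′ (πF γ)
    aγ≡ γ = trans (classify-resp (proj₁ (π-same (from γ))))
                  (cong (colourₚ (from a′)) (sym (strictlyInverseʳ (Inverse.to π (from γ)))))
    γb≡ : ∀ γ → col γ b ≡ col (πF γ) b′
    γb≡ γ = trans (classify-resp (proj₂ (π-same (from γ))))
                  (cong (λ p → colourₚ p (from b′)) (sym (strictlyInverseʳ (Inverse.to π (from γ)))))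

  cc : CC
  cc = record
    { n        = n
    ; k        = k
    ; col      = col
    ; col-onto = λ c → let ((p , q) , pq≡c) = colourₚ-onto c in to p , to q , trans (col-to p q) pq≡c
    ; diag     = λ a b b′ eq → from-injective (SameColour-diag (classify-reflect eq))
    ; transp   = λ c → let ((p , q) , pq≡c) = colourₚ-onto c in colourₚ q p , λ a b →
                   mk⇔ (λ ab≡c → classify-resp (SameColour-swap (classify-reflect (trans ab≡c (sym pq≡c)))))
                       (λ ba≡ → trans (classify-resp (SameColour-swap (classify-reflect ba≡))) pq≡c)
    ; inter    = col-inter
    }

  fibₚ : Fin m → Fin k
  fibₚ i = φₚ i ε⟨ i ⟩

  φₚ-fibres : ∀ {i g a b} → col a b ≡ φₚ i g → col a a ≡ fibₚ i × col b b ≡ fibₚ i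
  φₚ-fibres {i} {g} {a} {b} ab with from a | from b | Equivalence.to (col≡φ⇔Translate i g a b) ab
  ... | _ | _ | translate {x} {y} _ = Equivalence.from (colourₚ≡φₚ⇔Translate i ε⟨ i ⟩ (i , x) (i , x)) (Translate-refl i x)
                                    , Equivalence.from (colourₚ≡φₚ⇔Translate i ε⟨ i ⟩ (i , y) (i , y)) (Translate-refl i y)

  fibₚ-onto : ∀ d → IsFiber cc d → ∃ λ i → fibₚ i ≡ d
  fibₚ-onto d d-fib with ((i , x) , q) , pq≡d ← colourₚ-onto d
    with refl ← trans (sym (strictlyInverseʳ (i , x)))
                  (trans (cong from (d-fib (to (i , x)) (to q) (trans (col-to (i , x) q) pq≡d))) (strictlyInverseʳ q)) =
    i , trans (sym (Equivalence.from (colourₚ≡φₚ⇔Translate i ε⟨ i ⟩ (i , x) (i , x)) (Translate-refl i x))) pq≡d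

  φₚ-onto : ∀ i r → ContainedIn cc r (fibₚ i) (fibₚ i) → ∃ λ g → φₚ i g ≡ r
  φₚ-onto i r r-in with (p , q) , pq≡r ← colourₚ-onto r
    with pp , qq ← r-in (to p) (to q) (trans (col-to p q) pq≡r)
    with translate {x} _ ← Equivalence.to (colourₚ≡φₚ⇔Translate i ε⟨ i ⟩ p p) (trans (sym (col-to p p)) pp)
       | translate {y = y} _ ← Equivalence.to (colourₚ≡φₚ⇔Translate i ε⟨ i ⟩ q q) (trans (sym (col-to q q)) qq) =
    x ⁻¹⟨ i ⟩ ∙⟨ i ⟩ y ,
    trans (sym (Equivalence.from (colourₚ≡φₚ⇔Translate i (x ⁻¹⟨ i ⟩ ∙⟨ i ⟩ y) (i , x) (i , y)) (translate refl))) pq≡r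

  φₚ-inj : ∀ i g h → φₚ i g ≡ φₚ i h → g ≡ h
  φₚ-inj i g h eq =
    Translate-unique (translate-by-ε g) (Equivalence.to (colourₚ≡φₚ⇔Translate i h (i , ε⟨ i ⟩) (i , g)) eq)
    where
    translate-by-ε : ∀ g → Translate i g (i , ε⟨ i ⟩) (i , g)
    translate-by-ε g = subst (Translate i g (i , ε⟨ i ⟩)) (cong (i ,_) (Gᵢ.identityˡ i g)) (translate-by i ε⟨ i ⟩ g)

  φₚ-hom : ∀ i g h t → _∈_·_ cc t (φₚ i g) (φₚ i h) ⇔ (t ≡ φₚ i (g ∙⟨ i ⟩ h))
  φₚ-hom i g h t = mk⇔ hom⇒ hom⇐
    where
    hom⇒ : _∈_·_ cc t (φₚ i g) (φₚ i h) → t ≡ φₚ i (g ∙⟨ i ⟩ h)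
    hom⇒ t∈ with (p , q) , pq≡t ← colourₚ-onto t
      with γ , pγ , γq ← t∈ (to p) (to q) (trans (col-to p q) pq≡t) =
      trans (sym pq≡t) (trans (sym (col-to p q)) (Equivalence.from (col≡φ⇔Translate i (g ∙⟨ i ⟩ h) (to p) (to q))
        (Translate-∙ (Equivalence.to (col≡φ⇔Translate i g (to p) γ) pγ)
                     (Equivalence.to (col≡φ⇔Translate i h γ (to q)) γq))))
    hom⇐ : t ≡ φₚ i (g ∙⟨ i ⟩ h) → _∈_·_ cc t (φₚ i g) (φₚ i h)
    hom⇐ refl a b ab with q , pq , qr ← Translate-split (Equivalence.to (col≡φ⇔Translate i (g ∙⟨ i ⟩ h) a b) ab) =
      to q ,
      Equivalence.from (col≡φ⇔Translate i g a (to q))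
        (subst (Translate i g (from a)) (sym (strictlyInverseʳ q)) pq) ,
      Equivalence.from (col≡φ⇔Translate i h (to q) b)
        (subst (λ p → Translate i h p (from b)) (sym (strictlyInverseʳ q)) qr)

  typ : TypeG cc G
  typ = record
    { fib       = fibₚ
    ; fib-fiber = λ i a b ab → from-injective (Translate-ε (Equivalence.to (col≡φ⇔Translate i ε⟨ i ⟩ a b) ab))
    ; fib-inj   = λ i j eq →
                    Translate-fibre (Equivalence.to (colourₚ≡φₚ⇔Translate j ε⟨ j ⟩ (i , ε⟨ i ⟩) (i , ε⟨ i ⟩)) eq)
    ; fib-onto  = fibₚ-onto
    ; φ         = φₚ
    ; φ-in      = λ i g a b → φₚ-fibres
    ; φ-onto    = φₚ-onto
    ; φ-inj     = φₚ-inj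
    ; φ-hom     = φₚ-hom
    }

  quasi : Quasiregular cc
  quasi d d-fib r r-in with i , refl ← fibₚ-onto d d-fib with g , refl ← φₚ-onto i r r-in =
    (λ a b b′ ab ab′ → from-injective (Translate-functional (Translate-of ab) (Translate-of ab′))) ,
    (λ a a′ b ab a′b → from-injective (Translate-injective (Translate-of ab) (Translate-of a′b)))
    where
    Translate-of : ∀ {a b} → col a b ≡ φₚ i g → Translate i g (from a) (from b)
    Translate-of {a} {b} = Equivalence.to (col≡φ⇔Translate i g a b)

  configuration : QCfg G
  configuration = record { cc = cc ; quasi = quasi ; typ = typ }

  basePoints : BasePoints configuration
  basePoints i = to (i , ε⟨ i ⟩) , col-to (i , ε⟨ i ⟩) (i , ε⟨ i ⟩)

  private
    module C = Coordinates configuration basePoints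

  ι≡to : ∀ i x → C.ι i x ≡ to (i , x)
  ι≡to i x = sym (C.ι-unique (col-to (i , ε⟨ i ⟩) (i , x)))

  Linked≐R : C.Linked ≐ R
  Linked≐R i j x y = mk⇔
    (λ r → subst₂ (R i j) (Gᵢ.x//ε≈x i x) (Gᵢ.x//ε≈x j y)
             (R-of (classify-reflect (trans (sym (Col≡ x y)) (trans r (Col≡ ε⟨ i ⟩ ε⟨ j ⟩))))))
    (λ r → trans (Col≡ x y) (trans (classify-resp (same (subst₂ (R i j) (sym (Gᵢ.x//ε≈x i x)) (sym (Gᵢ.x//ε≈x j y)) r)))
                                   (sym (Col≡ ε⟨ i ⟩ ε⟨ j ⟩))))
    where
    Col≡ : ∀ x y → C.Col i j x y ≡ colourₚ (i , x) (j , y)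
    Col≡ x y = trans (cong₂ col (ι≡to i x) (ι≡to j y)) (col-to (i , x) (j , y))
    R-of : SameColour R (i , x) (j , y) (i , ε⟨ i ⟩) (j , ε⟨ j ⟩) →
           R i j (x //⟨ i ⟩ ε⟨ i ⟩) (y //⟨ j ⟩ ε⟨ j ⟩)
    R-of (same r) = r

theorem4p7 : {m : ℕ} (G : Fin m → FinGroup) →
    ((𝒳 : QCfg G) (α : BasePoints 𝒳) → Σ (LinkedQuotients G) (Realizes 𝒳 α))
    × ((L : LinkedQuotients G) → Σ (QCfg G) λ 𝒳 → Σ (BasePoints 𝒳) λ α → Realizes 𝒳 α L)
    × ((𝒳 𝒴 : QCfg G) (α : BasePoints 𝒳) (β : BasePoints 𝒴) (L : LinkedQuotients G) →
         Realizes 𝒳 α L → Realizes 𝒴 β L → Iso 𝒳 𝒴)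
    × ((𝒳 𝒴 : QCfg G) → Iso 𝒳 𝒴 → (α : BasePoints 𝒳) (L : LinkedQuotients G) →
         Realizes 𝒳 α L → Σ (BasePoints 𝒴) λ β → Realizes 𝒴 β L)
theorem4p7 G = realized , constructed , unique , transported
  where
  open Family G using (≐-sym; ≐-trans)
  open Coordinates using (Linked≐Graph⇒Realizes; Realizes⇒Linked≐Graph)

  realized : (𝒳 : QCfg G) (α : BasePoints 𝒳) → Σ (LinkedQuotients G) (Realizes 𝒳 α)
  realized 𝒳 α = linkedQuotients , Linked≐Graph⇒Realizes 𝒳 α linkedQuotients R≐Graph
    where open FromLinkedSubgroups (Coordinates.linkedSubgroupsOf 𝒳 α)

  constructed : (L : LinkedQuotients G) → Σ (QCfg G) λ 𝒳 → Σ (BasePoints 𝒳) λ α → Realizes 𝒳 α L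
  constructed L = configuration , basePoints , Linked≐Graph⇒Realizes configuration basePoints L Linked≐R
    where open ConfigurationOf (FromLinkedQuotients.linkedSubgroups L)

  unique : (𝒳 𝒴 : QCfg G) (α : BasePoints 𝒳) (β : BasePoints 𝒴) (L : LinkedQuotients G) →
           Realizes 𝒳 α L → Realizes 𝒴 β L → Iso 𝒳 𝒴
  unique 𝒳 𝒴 α β L 𝒳α⊨L 𝒴β⊨L =
    Linked≐⇒Iso 𝒳 𝒴 α β
      (≐-trans (Realizes⇒Linked≐Graph 𝒳 α L 𝒳α⊨L) (≐-sym (Realizes⇒Linked≐Graph 𝒴 β L 𝒴β⊨L)))

  transported : (𝒳 𝒴 : QCfg G) → Iso 𝒳 𝒴 → (α : BasePoints 𝒳) (L : LinkedQuotients G) →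
                Realizes 𝒳 α L → Σ (BasePoints 𝒴) λ β → Realizes 𝒴 β L
  transported 𝒳 𝒴 I α L 𝒳α⊨L = let β , 𝒴β≐𝒳α = Iso⇒Linked≐ 𝒳 𝒴 I α in
    β , Linked≐Graph⇒Realizes 𝒴 β L (≐-trans 𝒴β≐𝒳α (Realizes⇒Linked≐Graph 𝒳 α L 𝒳α⊨L))
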